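{- Let $q$ be a prime power. For $i=1,2,3,4$ let $\mathcal F_i\subseteq[m_i]\times[n_i]$ be an $m_i\times n_i$ Ferrers diagram, where $m_4\geq m_1+m_2$ and $n_4\geq n_2+n_3$; put $m=m_3+m_4$, $n=n_1+n_4$. Suppose $\mathcal F\subseteq[m]\times[n]$ is an $m\times n$ Ferrers diagram that is the disjoint union $$\mathcal F=\mathcal F_1\ \cup\ (\mathcal F_2+(m_1,n_1))\ \cup\ (\mathcal F_4+(0,n_1))\ \cup\ (\mathcal F_3+(m_4,n-n_3)),$$ where $S+(a,b)=\{(i+a,j+b):(i,j)\in S\}$. Suppose $\mathcal F_{12}$ is a Ferrers diagram which is a proper combination of $\mathcal F_1$ and $\mathcal F_2$, and that there exist an $[\mathcal F_{12},k_1,\delta_1]_q$ code, an $[\mathcal F_3,k_3,\delta_3]_q$ code and an $[\mathcal F_4,k_4,\delta_4]_q$ code. Then there exists an $[\mathcal F,\min\{k_1,k_3\}+k_4,\min\{\delta_1+\delta_3,\delta_4\}]_q$ code.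
   Context: $[a]$ denotes $\{0,1,\dots,a-1\}$. An $m\times n$ Ferrers diagram is a set $\mathcal F\subseteq[m]\times[n]$ of cells ("dots") such that: if $(i,j)\in\mathcal F$, $i\ge1$ then $(i-1,j)\in\mathcal F$; if $(i,j)\in\mathcal F$, $j\le n-2$ then $(i,j+1)\in\mathcal F$; row $0$ has $n$ dots and column $n-1$ has $m$ dots. An $[\mathcal F,k,\delta]_q$ code is a $k$-dimensional $\mathbb F_q$-linear subspace of $\mathbb F_q^{m\times n}$ all of whose matrices have zero entries outside $\mathcal F$ and whose nonzero matrices all have rank at least $\delta$. Given Ferrers diagrams $\mathcal F_1,\mathcal F_2$ and a Ferrers diagram $\mathcal G$, $\mathcal G$ is a proper combination of $\mathcal F_1$ and $\mathcal F_2$ if there are injections $\phi_l:\mathcal F_l\to\mathcal G$ ($l=1,2$) with $\phi_1(\mathcal F_1)\cap\phi_2(\mathcal F_2)=\varnothing$, $|\mathcal F_1|+|\mathcal F_2|=|\mathcal G|$, and such that for each $l$ and any two distinct cells of $\mathcal F_l$ lying in the same row or in the same column, their images under $\phi_l$ lie in the same row or in the same column of $\mathcal G$. -}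

module Defs where

open import Level using (Level; _⊔_)
open import Data.Nat using (ℕ; zero; suc; _+_; _∸_; _^_; _≤_; _<_; _≤ᵇ_)
open import Data.Nat.Primality using (Prime)
open import Data.Fin using (Fin; toℕ)
import Data.Fin as Fin
open import Data.Bool using (Bool; true; false; _∧_; if_then_else_)
open import Data.Product using (Σ; ∃; _×_; _,_; proj₁; proj₂)
open import Data.Sum using (_⊎_)
open import Relation.Nullary using (¬_)
open import Relation.Binary.PropositionalEquality using (_≡_; _≢_)
open import Algebra.Bundles using (CommutativeRing)

IsPrimePower : ℕ → Set
IsPrimePower q = Σ ℕ λ p → Σ ℕ λ e → Prime p × 1 ≤ e × q ≡ p ^ e

module _ {c ℓ : Level} (R : CommutativeRing c ℓ) where
  open CommutativeRing R renaming (_+_ to _+ᴿ_; _*_ to _*ᴿ_)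

  IsField : Set (c ⊔ ℓ)
  IsField = (¬ (0# ≈ 1#)) × (∀ x → ¬ (x ≈ 0#) → Σ Carrier λ y → x *ᴿ y ≈ 1#)

  HasCardinality : ℕ → Set (c ⊔ ℓ)
  HasCardinality q = Σ (Fin q → Carrier) λ e →
    (∀ a b → e a ≈ e b → a ≡ b) × (∀ x → Σ (Fin q) λ a → e a ≈ x)

  IsFiniteField : ℕ → Set (c ⊔ ℓ)
  IsFiniteField q = IsField × HasCardinality q

  Matrix : ℕ → ℕ → Set c
  Matrix m n = Fin m → Fin n → Carrier

  ∑ : (k : ℕ) → (Fin k → Carrier) → Carrier
  ∑ zero    f = 0#
  ∑ (suc k) f = f Fin.zero +ᴿ ∑ k (λ i → f (Fin.suc i))

  comb : ∀ {k m n} → (Fin k → Carrier) → (Fin k → Matrix m n) → Matrix m n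
  comb {k} cs B i j = ∑ k (λ l → cs l *ᴿ B l i j)

  IsZeroMatrix : ∀ {m n} → Matrix m n → Set ℓ
  IsZeroMatrix M = ∀ i j → M i j ≈ 0#

  RankAtLeast : ∀ {m n} → ℕ → Matrix m n → Set (c ⊔ ℓ)
  RankAtLeast {m} {n} δ M = Σ (Fin δ → Fin m) λ r →
    (∀ a b → r a ≡ r b → a ≡ b) ×
    (∀ (cs : Fin δ → Carrier) →
       (∀ j → ∑ δ (λ l → cs l *ᴿ M (r l) j) ≈ 0#) → ∀ l → cs l ≈ 0#)

Diagram : Set
Diagram = ℕ → ℕ → Bool

_∈D_ : ℕ × ℕ → Diagram → Set
(i , j) ∈D D = D i j ≡ true

IsFerrers : ℕ → ℕ → Diagram → Set
IsFerrers m n D =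
  (∀ i j → (i , j) ∈D D → i < m × j < n) ×
  (∀ i j → (suc i , j) ∈D D → (i , j) ∈D D) ×
  (∀ i j → suc j < n → (i , j) ∈D D → (i , suc j) ∈D D) ×
  (0 < m × (∀ j → j < n → (0 , j) ∈D D)) ×
  (0 < n × (∀ i → i < m → (i , n ∸ 1) ∈D D))

shift : Diagram → ℕ → ℕ → Diagram
shift S a b i j = (a ≤ᵇ i) ∧ ((b ≤ᵇ j) ∧ S (i ∸ a) (j ∸ b))

b2n : Bool → ℕ
b2n true  = 1
b2n false = 0

-- F is the disjoint union of A, B, C, D: every cell lies in exactly as
-- many of A, B, C, D as it lies in F (0 or 1).
IsDisjointUnion4 : Diagram → Diagram → Diagram → Diagram → Diagram → Set
IsDisjointUnion4 F A B C D = ∀ i j →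
  b2n (F i j) ≡ b2n (A i j) + b2n (B i j) + b2n (C i j) + b2n (D i j)

countRow : (i : ℕ) → ℕ → Diagram → ℕ
countRow i zero    D = 0
countRow i (suc n) D = countRow i n D + b2n (D i n)

card : ℕ → ℕ → Diagram → ℕ
card zero    n D = 0
card (suc m) n D = card m n D + countRow m n D

Cell : Diagram → Set
Cell D = Σ (ℕ × ℕ) λ p → p ∈D D

SameLine : ℕ × ℕ → ℕ × ℕ → Set
SameLine (i , j) (i' , j') = i ≡ i' ⊎ j ≡ j'

PreservesLines : {D G : Diagram} → (Cell D → Cell G) → Set
PreservesLines {D} φ = ∀ (x y : Cell D) → proj₁ x ≢ proj₁ y →
  SameLine (proj₁ x) (proj₁ y) → SameLine (proj₁ (φ x)) (proj₁ (φ y))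

IsProperCombination : (m1 n1 : ℕ) → Diagram → (m2 n2 : ℕ) → Diagram →
                      (mG nG : ℕ) → Diagram → Set
IsProperCombination m1 n1 F1 m2 n2 F2 mG nG G =
  Σ (Cell F1 → Cell G) λ φ1 → Σ (Cell F2 → Cell G) λ φ2 →
    (∀ x y → proj₁ (φ1 x) ≡ proj₁ (φ1 y) → proj₁ x ≡ proj₁ y) ×
    (∀ x y → proj₁ (φ2 x) ≡ proj₁ (φ2 y) → proj₁ x ≡ proj₁ y) ×
    (∀ x y → proj₁ (φ1 x) ≢ proj₁ (φ2 y)) ×
    (card m1 n1 F1 + card m2 n2 F2 ≡ card mG nG G) ×
    PreservesLines φ1 × PreservesLines φ2

-- [D, k, δ] rank-metric Ferrers diagram code over the field R, as
-- matrices of size m × n: a k-dimensional subspace, given by a basis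
-- B_0..B_{k-1}, whose matrices vanish outside D and whose nonzero
-- elements have rank ≥ δ.

module _ {c ℓ : Level} (R : CommutativeRing c ℓ) where
  open CommutativeRing R renaming (_+_ to _+ᴿ_; _*_ to _*ᴿ_)

  IsFDCode : (m n : ℕ) → Diagram → (k δ : ℕ) → (Fin k → Matrix R m n) → Set (c ⊔ ℓ)
  IsFDCode m n D k δ B =
    (∀ (cs : Fin k → Carrier) → IsZeroMatrix R (comb R cs B) → ∀ l → cs l ≈ 0#) ×
    (∀ l (i : Fin m) (j : Fin n) → D (toℕ i) (toℕ j) ≡ false → B l i j ≈ 0#) ×
    (∀ (cs : Fin k → Carrier) → ¬ IsZeroMatrix R (comb R cs B) →
       RankAtLeast R δ (comb R cs B))

  FDCodeExists : (m n : ℕ) → Diagram → (k δ : ℕ) → Set (c ⊔ ℓ)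
  FDCodeExists m n D k δ = Σ (Fin k → Matrix R m n) (IsFDCode m n D k δ)

-- A codeword of the new code places three codewords: a codeword C of the F₁₂-code, pulled back along the
-- two embeddings of the proper combination onto F₁ and F₂ + (m₁, n₁); a codeword of the F₃-code on
-- F₃ + (m₄, n − n₃); and a codeword of the F₄-code on F₄ + (0, n₁).  The F₁₂- and F₃-codewords share their
-- first min(k₁, k₃) coefficients.  If these shared coefficients vanish, the codeword is the placed
-- F₄-codeword, of rank ≥ δ₄.  Otherwise the F₁-, F₂- and F₃-blocks are block triangular (rows through F₂
-- and F₃ vanish on the columns of F₁, rows through F₃ on those of F₂), so the rank is at least
-- r₁ + r₂ + δ₃, where rₗ is the rank of the piece pulled back to Fₗ.  Finally r₁ + r₂ ≥ rank C ≥ δ₁: a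
-- line-preserving injection of a Ferrers diagram maps it into one line or as a (possibly transposed)
-- product ρ × κ, so the part of C on the image of Fₗ has its rows in the span of rₗ vectors, and C is the
-- sum of its two parts.

module Submission where

open import Defs
open import Level using (Level; _⊔_)
open import Data.Nat using (ℕ; zero; suc; _+_; _∸_; _≤_; _<_; _^_; _⊓_; _≤ᵇ_; z≤n; s≤s)
import Data.Nat.Properties as ℕ
open import Data.Fin as Fin using (Fin; toℕ; fromℕ<; inject≤; _↑ˡ_; _↑ʳ_; splitAt; funToFin; finToFun)
import Data.Fin.Properties as Fin
open import Data.Vec.Functional as V using (Vector; _++_)
open import Data.Vec.Functional.Properties using (lookup-++ˡ; lookup-++ʳ)
open import Data.Bool using (Bool; true; false; T; _∧_; if_then_else_)
import Data.Bool.Properties as Bool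
open import Data.Product using (Σ; ∃; _×_; _,_; proj₁; proj₂; swap)
open import Data.Product.Properties using (≡-dec; ×-≡,≡→≡)
open import Data.Sum as Sum using (_⊎_; inj₁; inj₂)
open import Data.Empty using (⊥; ⊥-elim)
open import Data.Unit using (⊤; tt)
open import Data.List using (List; []; _∷_; length; lookup) renaming (_++_ to _++ᴸ_)
import Data.List.Properties as List
open import Data.List.Membership.Propositional using (_∈_)
import Data.List.Membership.Propositional.Properties as ∈
open import Data.List.Relation.Unary.Any as Any using (here)
import Data.List.Relation.Unary.Any.Properties as Any
import Data.List.Relation.Unary.All as All
open import Data.List.Relation.Unary.AllPairs using ([]; _∷_)
open import Data.List.Relation.Unary.Unique.Propositional using (Unique)
import Data.List.Relation.Unary.Unique.Propositional.Properties as Unique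
open import Function using (_∘_; Equivalence)
open import Function.Definitions using (Injective)
open import Relation.Nullary using (¬_; Dec; yes; no)
open import Relation.Binary.PropositionalEquality as ≡ using (_≡_; _≢_; _≗_)
open import Algebra.Bundles using (CommutativeRing)
import Algebra.Properties.Semiring.Sum as SemiringSum
import Algebra.Properties.Ring as RingProperties
import Algebra.Properties.Group as GroupProperties
import Relation.Binary.Reasoning.Setoid as SetoidReasoning
import Axiom.UniquenessOfIdentityProofs as UIP

n∸1<n : ∀ {n} → 0 < n → n ∸ 1 < n
n∸1<n = ℕ.∸-monoʳ-< {o = 0} (s≤s z≤n)

Fin+-elim : ∀ {m n p} {P : Fin (m + n) → Set p} →
  (∀ i → P (i ↑ˡ n)) → (∀ j → P (m ↑ʳ j)) → ∀ k → P k
Fin+-elim {m} {P = P} left right k with splitAt m k in eq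
... | inj₁ i = ≡.subst P (Fin.splitAt⁻¹-↑ˡ eq) (left i)
... | inj₂ j = ≡.subst P (Fin.splitAt⁻¹-↑ʳ eq) (right j)

++-injective : ∀ {a b ℓx} {X : Set ℓx} (f : Vector X a) (g : Vector X b) →
  Injective _≡_ _≡_ f → Injective _≡_ _≡_ g → (∀ i j → f i ≢ g j) →
  Injective _≡_ _≡_ (f ++ g)
++-injective {a} {b} f g f-inj g-inj f≢g {x} {y} e
  with splitAt a x in ex | splitAt a y in ey
... | inj₁ i | inj₁ i′ =
  ≡.trans (≡.sym (Fin.splitAt⁻¹-↑ˡ ex)) (≡.trans (≡.cong (_↑ˡ b) (f-inj e)) (Fin.splitAt⁻¹-↑ˡ ey))
... | inj₁ i | inj₂ j′ = ⊥-elim (f≢g i j′ e)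
... | inj₂ j | inj₁ i′ = ⊥-elim (f≢g i′ j (≡.sym e))
... | inj₂ j | inj₂ j′ =
  ≡.trans (≡.sym (Fin.splitAt⁻¹-↑ʳ ex)) (≡.trans (≡.cong (a ↑ʳ_) (g-inj e)) (Fin.splitAt⁻¹-↑ʳ ey))

functions-injection⇒≤ : ∀ {q d r} (F : (Fin d → Fin q) → (Fin r → Fin q)) →
  (∀ a b → F a ≗ F b → a ≗ b) → q ^ d ≤ q ^ r
functions-injection⇒≤ {q} {d} {r} F F-inj = Fin.injective⇒≤ {f = code} code-inj
  where
  code : Fin (q ^ d) → Fin (q ^ r)
  code k = funToFin (F (finToFun k))
  funToFin-cong : ∀ {m n} {f g : Fin m → Fin n} → f ≗ g → funToFin f ≡ funToFin g
  funToFin-cong {zero} _ = ≡.refl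
  funToFin-cong {suc m} f≗g = ≡.cong₂ Fin.combine (f≗g Fin.zero) (funToFin-cong (f≗g ∘ Fin.suc))
  code-inj : Injective _≡_ _≡_ code
  code-inj {k} {k′} e = ≡.trans (≡.sym (Fin.funToFin-finToFin {d} {q} k))
    (≡.trans (funToFin-cong (F-inj _ _ λ t →
               ≡.trans (≡.sym (Fin.finToFun-funToFin (F (finToFun k)) t))
                 (≡.trans (≡.cong (λ z → finToFun z t) e) (Fin.finToFun-funToFin (F (finToFun k′)) t))))
             (Fin.funToFin-finToFin {d} {q} k′))

^-cancelˡ-≤ : ∀ {q d r} → 1 < q → q ^ d ≤ q ^ r → d ≤ r
^-cancelˡ-≤ {q} 1<q q^d≤q^r = ℕ.≮⇒≥ λ r<d → ℕ.<⇒≱ (ℕ.^-monoʳ-< q 1<q r<d) q^d≤q^r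

-- Linear algebra over a finite field

module Sums {c ℓ : Level} (R : CommutativeRing c ℓ) where
  open CommutativeRing R renaming (_+_ to _+ᴿ_; _*_ to _*ᴿ_)
  open SemiringSum semiring using (sum; sum-cong-≋; sum-replicate-zero; *-distribˡ-sum)
    renaming (∑-distrib-+ to sum-distrib-+; ∑-comm to sum-comm)
  open RingProperties ring using (-‿distribˡ-*)
  open SetoidReasoning setoid

  ∑≡sum : ∀ k (f : Fin k → Carrier) → ∑ R k f ≡ sum f
  ∑≡sum zero f = ≡.refl
  ∑≡sum (suc k) f = ≡.cong (f Fin.zero +ᴿ_) (∑≡sum k (f ∘ Fin.suc))

  ∑-cong : ∀ k {f g : Fin k → Carrier} → (∀ i → f i ≈ g i) → ∑ R k f ≈ ∑ R k g
  ∑-cong k {f} {g} f≈g = trans (reflexive (∑≡sum k f)) (trans (sum-cong-≋ f≈g) (reflexive (≡.sym (∑≡sum k g))))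

  ∑-zero : ∀ k {f : Fin k → Carrier} → (∀ i → f i ≈ 0#) → ∑ R k f ≈ 0#
  ∑-zero k {f} f≈0 = trans (reflexive (∑≡sum k f)) (trans (sum-cong-≋ f≈0) (sum-replicate-zero k))

  ∑-distrib-+ : ∀ k (f g : Fin k → Carrier) → ∑ R k (λ i → f i +ᴿ g i) ≈ ∑ R k f +ᴿ ∑ R k g
  ∑-distrib-+ k f g = trans (reflexive (∑≡sum k _))
    (trans (sum-distrib-+ f g) (+-cong (reflexive (≡.sym (∑≡sum k f))) (reflexive (≡.sym (∑≡sum k g)))))

  *-distribˡ-∑ : ∀ k x (f : Fin k → Carrier) → x *ᴿ ∑ R k f ≈ ∑ R k (λ i → x *ᴿ f i)
  *-distribˡ-∑ k x f = trans (*-congˡ (reflexive (∑≡sum k f)))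
    (trans (*-distribˡ-sum x f) (reflexive (≡.sym (∑≡sum k _))))

  *-distribʳ-∑ : ∀ k x (f : Fin k → Carrier) → ∑ R k f *ᴿ x ≈ ∑ R k (λ i → f i *ᴿ x)
  *-distribʳ-∑ k x f = trans (*-comm _ x) (trans (*-distribˡ-∑ k x f) (∑-cong k λ i → *-comm x (f i)))

  ∑-comm : ∀ a b (f : Fin a → Fin b → Carrier) →
    ∑ R a (λ i → ∑ R b (f i)) ≈ ∑ R b (λ j → ∑ R a (λ i → f i j))
  ∑-comm a b f = begin
    ∑ R a (λ i → ∑ R b (f i))    ≈⟨ ∑-cong a (λ i → reflexive (∑≡sum b (f i))) ⟩
    ∑ R a (λ i → sum (f i))      ≡⟨ ∑≡sum a _ ⟩
    sum (λ i → sum (f i))        ≈⟨ sum-comm f ⟩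
    sum (λ j → sum (λ i → f i j)) ≡⟨ ∑≡sum b _ ⟨
    ∑ R b (λ j → sum (λ i → f i j)) ≈⟨ ∑-cong b (λ j → reflexive (≡.sym (∑≡sum a _))) ⟩
    ∑ R b (λ j → ∑ R a (λ i → f i j)) ∎

  ∑-neg : ∀ k (f : Fin k → Carrier) → ∑ R k (λ i → - f i) ≈ - ∑ R k f
  ∑-neg k f = begin
    ∑ R k (λ i → - f i)          ≈⟨ ∑-cong k (λ i → trans (-‿cong (sym (*-identityˡ _))) (-‿distribˡ-* 1# (f i))) ⟩
    ∑ R k (λ i → (- 1#) *ᴿ f i)  ≈⟨ *-distribˡ-∑ k (- 1#) f ⟨
    (- 1#) *ᴿ ∑ R k f            ≈⟨ -‿distribˡ-* 1# _ ⟨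
    - (1# *ᴿ ∑ R k f)            ≈⟨ -‿cong (*-identityˡ _) ⟩
    - ∑ R k f                    ∎

  ∑-split : ∀ a b (f : Fin (a + b) → Carrier) →
    ∑ R (a + b) f ≈ ∑ R a (λ i → f (i ↑ˡ b)) +ᴿ ∑ R b (λ j → f (a ↑ʳ j))
  ∑-split zero b f = sym (+-identityˡ _)
  ∑-split (suc a) b f = trans (+-congˡ (∑-split a b (f ∘ Fin.suc))) (sym (+-assoc _ _ _))

module Span {c ℓ : Level} (R : CommutativeRing c ℓ) where
  open CommutativeRing R renaming (_+_ to _+ᴿ_; _*_ to _*ᴿ_)
  open Sums R
  open RingProperties ring using (-‿distribˡ-*)
  open SetoidReasoning setoid

  linComb : ∀ {d N} → (Fin d → Carrier) → (Fin d → Vector Carrier N) → Vector Carrier N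
  linComb {d} cs V j = ∑ R d (λ l → cs l *ᴿ V l j)

  Independent : ∀ {d N} → (Fin d → Vector Carrier N) → Set (c ⊔ ℓ)
  Independent V = ∀ cs → (∀ j → linComb cs V j ≈ 0#) → ∀ l → cs l ≈ 0#

  IndependentOn : ∀ {d N} → (Fin N → Set) → (Fin d → Vector Carrier N) → Set (c ⊔ ℓ)
  IndependentOn P V = ∀ cs → (∀ j → P j → linComb cs V j ≈ 0#) → ∀ l → cs l ≈ 0#

  infix 4 _∈Span_
  _∈Span_ : ∀ {r N} → Vector Carrier N → (Fin r → Vector Carrier N) → Set (c ⊔ ℓ)
  _∈Span_ {r} v W = Σ (Fin r → Carrier) λ β → ∀ j → v j ≈ linComb β W j

  linComb-zeroˡ : ∀ {d N} {cs : Fin d → Carrier} (V : Fin d → Vector Carrier N) →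
    (∀ l → cs l ≈ 0#) → ∀ j → linComb cs V j ≈ 0#
  linComb-zeroˡ {d} V cs≈0 j = ∑-zero d (λ l → trans (*-congʳ (cs≈0 l)) (zeroˡ _))

  linComb-zeroʳ : ∀ {d N} (cs : Fin d → Carrier) (V : Fin d → Vector Carrier N) {j} →
    (∀ l → V l j ≈ 0#) → linComb cs V j ≈ 0#
  linComb-zeroʳ {d} cs V V≈0 = ∑-zero d (λ l → trans (*-congˡ (V≈0 l)) (zeroʳ _))

  linComb-congˡ : ∀ {d N} {cs cs′ : Fin d → Carrier} (V : Fin d → Vector Carrier N) →
    (∀ l → cs l ≈ cs′ l) → ∀ j → linComb cs V j ≈ linComb cs′ V j
  linComb-congˡ {d} V cs≈cs′ j = ∑-cong d (λ l → *-congʳ (cs≈cs′ l))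

  linComb-congʳ : ∀ {d N} (cs : Fin d → Carrier) (V V′ : Fin d → Vector Carrier N) {j} →
    (∀ l → V l j ≈ V′ l j) → linComb cs V j ≈ linComb cs V′ j
  linComb-congʳ {d} cs V V′ V≈V′ = ∑-cong d (λ l → *-congˡ (V≈V′ l))

  linComb-++ : ∀ {a b N} (cs : Fin a → Carrier) (cs′ : Fin b → Carrier) (V : Fin a → Vector Carrier N)
    (V′ : Fin b → Vector Carrier N) j →
    linComb (cs ++ cs′) (V ++ V′) j ≈ linComb cs V j +ᴿ linComb cs′ V′ j
  linComb-++ {a} {b} cs cs′ V V′ j = trans (∑-split a b _) (+-cong
    (∑-cong a (λ i → reflexive (≡.cong₂ (λ x v → x *ᴿ v j) (lookup-++ˡ cs cs′ i) (lookup-++ˡ V V′ i))))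
    (∑-cong b (λ i → reflexive (≡.cong₂ (λ x v → x *ᴿ v j) (lookup-++ʳ cs cs′ i) (lookup-++ʳ V V′ i)))))

  linComb-sub : ∀ {d N} (xs ys : Fin d → Carrier) (V : Fin d → Vector Carrier N) j →
    linComb (λ l → xs l +ᴿ - ys l) V j ≈ linComb xs V j +ᴿ - linComb ys V j
  linComb-sub {d} xs ys V j = begin
    linComb (λ l → xs l +ᴿ - ys l) V j                        ≈⟨ ∑-cong d (λ l → distribʳ _ _ _) ⟩
    ∑ R d (λ l → xs l *ᴿ V l j +ᴿ (- ys l) *ᴿ V l j)         ≈⟨ ∑-distrib-+ d _ _ ⟩
    linComb xs V j +ᴿ ∑ R d (λ l → (- ys l) *ᴿ V l j)        ≈⟨ +-congˡ (∑-cong d (λ l → sym (-‿distribˡ-* _ _))) ⟩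
    linComb xs V j +ᴿ ∑ R d (λ l → - (ys l *ᴿ V l j))        ≈⟨ +-congˡ (∑-neg d _) ⟩
    linComb xs V j +ᴿ - linComb ys V j                        ∎

  linComb-∈Span : ∀ {d r N} (cs : Fin d → Carrier) (V : Fin d → Vector Carrier N)
    (W : Fin r → Vector Carrier N) (β : Fin d → Fin r → Carrier) →
    (∀ l j → V l j ≈ linComb (β l) W j) →
    ∀ j → linComb cs V j ≈ linComb (linComb cs β) W j
  linComb-∈Span {d} {r} cs V W β V≈ j = begin
    linComb cs V j                                          ≈⟨ linComb-congʳ cs V (λ l j → linComb (β l) W j) (λ l → V≈ l j) ⟩
    ∑ R d (λ l → cs l *ᴿ ∑ R r (λ t → β l t *ᴿ W t j))     ≈⟨ ∑-cong d (λ l → *-distribˡ-∑ r (cs l) _) ⟩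
    ∑ R d (λ l → ∑ R r (λ t → cs l *ᴿ (β l t *ᴿ W t j)))   ≈⟨ ∑-comm d r _ ⟩
    ∑ R r (λ t → ∑ R d (λ l → cs l *ᴿ (β l t *ᴿ W t j)))   ≈⟨ ∑-cong r (λ t → ∑-cong d (λ l → sym (*-assoc _ _ _))) ⟩
    ∑ R r (λ t → ∑ R d (λ l → (cs l *ᴿ β l t) *ᴿ W t j))   ≈⟨ ∑-cong r (λ t → sym (*-distribʳ-∑ d _ _)) ⟩
    linComb (linComb cs β) W j                              ∎

  ∈Span-zero : ∀ {r N} {v : Vector Carrier N} (W : Fin r → Vector Carrier N) →
    (∀ j → v j ≈ 0#) → v ∈Span W
  ∈Span-zero W v≈0 = (λ _ → 0#) , λ j → trans (v≈0 j) (sym (linComb-zeroˡ W (λ _ → refl) j))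

  ∈Span-∷ : ∀ {r N} {v w : Vector Carrier N} {W : Fin r → Vector Carrier N} →
    v ∈Span W → v ∈Span (w V.∷ W)
  ∈Span-∷ (β , v≈) = (0# V.∷ β) , λ j → trans (v≈ j) (sym (trans (+-congʳ (zeroˡ _)) (+-identityˡ _)))

  ∈Span-head : ∀ {r N} (w : Vector Carrier N) (W : Fin r → Vector Carrier N) → w ∈Span (w V.∷ W)
  ∈Span-head {r} w W = (1# V.∷ λ _ → 0#) , λ j →
    sym (trans (+-cong (*-identityˡ _) (linComb-zeroˡ W (λ _ → refl) j)) (+-identityʳ _))

  independentOn-++ : ∀ {a b m N} {P Q U : Fin N → Set} (M : Fin m → Vector Carrier N)
    (f : Fin a → Fin m) (g : Fin b → Fin m) →
    IndependentOn P (M ∘ f) → IndependentOn Q (M ∘ g) → (∀ i j → P j → M (g i) j ≈ 0#) →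
    (∀ j → P j → U j) → (∀ j → Q j → U j) → IndependentOn U (M ∘ (f ++ g))
  independentOn-++ {a} {b} {U = U} M f g f-independent g-independent g≈0 P⊆U Q⊆U cs cs≈0 =
    Fin+-elim left≈0 right≈0
    where
    left : Fin a → Carrier
    left i = cs (i ↑ˡ b)
    right : Fin b → Carrier
    right i = cs (a ↑ʳ i)
    split : ∀ j → U j → linComb left (M ∘ f) j +ᴿ linComb right (M ∘ g) j ≈ 0#
    split j uj = trans (sym (+-cong
      (∑-cong a (λ i → *-congˡ (reflexive (≡.cong (λ r → M r j) (lookup-++ˡ f g i)))))
      (∑-cong b (λ i → *-congˡ (reflexive (≡.cong (λ r → M r j) (lookup-++ʳ f g i)))))))
      (trans (sym (∑-split a b _)) (cs≈0 j uj))
    left≈0 : ∀ i → left i ≈ 0#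
    left≈0 = f-independent left λ j pj → trans (sym (+-identityʳ _))
      (trans (+-congˡ (sym (linComb-zeroʳ right (M ∘ g) (λ i → g≈0 i j pj)))) (split j (P⊆U j pj)))
    right≈0 : ∀ i → right i ≈ 0#
    right≈0 = g-independent right λ j qj → trans (sym (+-identityˡ _))
      (trans (+-congʳ (sym (linComb-zeroˡ (M ∘ f) left≈0 j))) (split j (Q⊆U j qj)))

  independentOn-embed : ∀ {d N N′} {P : Fin N → Set} {V : Fin d → Vector Carrier N}
    {U : Fin d → Vector Carrier N′} (e : Fin N′ → Fin N) →
    (∀ j → P (e j)) → (∀ l j → V l (e j) ≈ U l j) → Independent U → IndependentOn P V
  independentOn-embed {V = V} {U} e P∘e V≈U U-ind cs cs≈0 =
    U-ind cs λ j → trans (sym (linComb-congʳ cs (λ l → V l ∘ e) U (λ l → V≈U l j))) (cs≈0 (e j) (P∘e j))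

  padZero : ∀ {d′ d} → d′ ≤ d → (Fin d′ → Carrier) → Fin d → Carrier
  padZero {zero} _ cs l = 0#
  padZero {suc d′} (s≤s h) cs Fin.zero = cs Fin.zero
  padZero {suc d′} (s≤s h) cs (Fin.suc l) = padZero h (cs ∘ Fin.suc) l

  padZero-inject≤ : ∀ {d′ d} (h : d′ ≤ d) (cs : Fin d′ → Carrier) l → padZero h cs (inject≤ l h) ≡ cs l
  padZero-inject≤ (s≤s h) cs Fin.zero = ≡.refl
  padZero-inject≤ (s≤s h) cs (Fin.suc l) = padZero-inject≤ h (cs ∘ Fin.suc) l

  ∑-padZero : ∀ {d′ d} (h : d′ ≤ d) (cs : Fin d′ → Carrier) (g : Fin d → Carrier) →
    ∑ R d (λ l → padZero h cs l *ᴿ g l) ≈ ∑ R d′ (λ l → cs l *ᴿ g (inject≤ l h))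
  ∑-padZero {zero} {d} h cs g = ∑-zero d (λ l → zeroˡ _)
  ∑-padZero {suc d′} (s≤s h) cs g = +-congˡ (∑-padZero h (cs ∘ Fin.suc) (g ∘ Fin.suc))

  independent-inject≤ : ∀ {d′ d N} (h : d′ ≤ d) {V : Fin d → Vector Carrier N} →
    Independent V → Independent (λ l → V (inject≤ l h))
  independent-inject≤ h {V} V-ind cs cs≈0 l = trans (reflexive (≡.sym (padZero-inject≤ h cs l)))
    (V-ind (padZero h cs) (λ j → trans (∑-padZero h cs (λ l → V l j)) (cs≈0 j)) (inject≤ l h))

module FiniteField {c ℓ : Level} (R : CommutativeRing c ℓ) (isField : IsField R)
  {q : ℕ} (card : HasCardinality R q) where
  open CommutativeRing R renaming (_+_ to _+ᴿ_; _*_ to _*ᴿ_)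
  open Sums R
  open Span R
  open RingProperties ring using (-‿distribˡ-*; -‿distribʳ-*)
  open GroupProperties +-group using (x∙y⁻¹≈ε⇒x≈y; x≈y⇒x∙y⁻¹≈ε; inverseˡ-unique)
  open SetoidReasoning setoid

  private
    element : Fin q → Carrier
    element = proj₁ card

    element-injective : ∀ a b → element a ≈ element b → a ≡ b
    element-injective = proj₁ (proj₂ card)

    index : Carrier → Fin q
    index x = proj₁ (proj₂ (proj₂ card) x)

    element-index : ∀ x → element (index x) ≈ x
    element-index x = proj₂ (proj₂ (proj₂ card) x)

  _≈?_ : ∀ x y → Dec (x ≈ y)
  x ≈? y with index x Fin.≟ index y
  ... | yes e = yes (trans (sym (element-index x)) (trans (reflexive (≡.cong element e)) (element-index y)))
  ... | no ne = no λ x≈y → ne (element-injective _ _ (trans (element-index x) (trans x≈y (sym (element-index y)))))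

  1<q : 1 < q
  1<q = distinct⇒1< (index 0#) (index 1#) λ e →
    proj₁ isField (trans (sym (element-index 0#)) (trans (reflexive (≡.cong element e)) (element-index 1#)))
    where
    distinct⇒1< : ∀ {n} (a b : Fin n) → a ≢ b → 1 < n
    distinct⇒1< {suc zero} Fin.zero Fin.zero a≢b = ⊥-elim (a≢b ≡.refl)
    distinct⇒1< {suc (suc n)} _ _ _ = s≤s (s≤s z≤n)

  ∈Span? : ∀ {r N} (v : Vector Carrier N) (W : Fin r → Vector Carrier N) → Dec (v ∈Span W)
  ∈Span? {r} v W with Fin.any? (λ k → Fin.all? (λ j → v j ≈? linComb (element ∘ finToFun k) W j))
  ... | yes (k , v≈) = yes (element ∘ finToFun k , v≈)
  ... | no ¬v∈W = no λ (β , v≈) → ¬v∈W (funToFin (index ∘ β) , λ j →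
    trans (v≈ j) (linComb-congˡ W (λ t → trans (sym (element-index (β t)))
      (reflexive (≡.cong element (≡.sym (Fin.finToFun-funToFin (index ∘ β) t))))) j))

  -- Distinct coefficient vectors over F_q give distinct coordinate vectors in W, so q ^ d ≤ q ^ r.
  independent-in-span⇒≤ : ∀ {d r N} {V : Fin d → Vector Carrier N} {W : Fin r → Vector Carrier N} →
    Independent V → (∀ l → V l ∈Span W) → d ≤ r
  independent-in-span⇒≤ {d} {r} {V = V} {W} V-ind V∈W =
    ^-cancelˡ-≤ 1<q (functions-injection⇒≤ coordinates coordinates-injective)
    where
    β : Fin d → Vector Carrier r
    β l = proj₁ (V∈W l)
    coordinates : (Fin d → Fin q) → Fin r → Fin q
    coordinates a t = index (linComb (element ∘ a) β t)
    coordinates-injective : ∀ a b → coordinates a ≗ coordinates b → a ≗ b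
    coordinates-injective a b same l = element-injective _ _ (x∙y⁻¹≈ε⇒x≈y _ _ (V-ind diff diff≈0 l))
      where
      diff : Fin d → Carrier
      diff l = element (a l) +ᴿ - element (b l)
      diffβ≈0 : ∀ t → linComb diff β t ≈ 0#
      diffβ≈0 t = trans (linComb-sub (element ∘ a) (element ∘ b) β t) (x≈y⇒x∙y⁻¹≈ε
        (trans (sym (element-index _)) (trans (reflexive (≡.cong element (same t))) (element-index _))))
      diff≈0 : ∀ j → linComb diff V j ≈ 0#
      diff≈0 j = trans (linComb-∈Span diff V W β (λ l → proj₂ (V∈W l)) j) (linComb-zeroˡ W diffβ≈0 j)

  independent-∷ : ∀ {r N} {w : Vector Carrier N} {W : Fin r → Vector Carrier N} →
    Independent W → ¬ w ∈Span W → Independent (w V.∷ W)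
  independent-∷ {r} {w = w} {W} W-ind w∉W cs cs≈0 with cs Fin.zero ≈? 0#
  ... | yes c₀≈0 = λ { Fin.zero → c₀≈0 ; (Fin.suc l) → W-ind (cs ∘ Fin.suc) tail≈0 l }
    where
    tail≈0 : ∀ j → linComb (cs ∘ Fin.suc) W j ≈ 0#
    tail≈0 j = trans (sym (+-identityˡ _))
      (trans (+-congʳ (sym (trans (*-congʳ c₀≈0) (zeroˡ _)))) (cs≈0 j))
  ... | no c₀≉0 = ⊥-elim (w∉W (β , w≈))
    where
    c₀ : Carrier
    c₀ = cs Fin.zero
    y : Carrier
    y = proj₁ (proj₂ isField c₀ c₀≉0)
    β : Fin r → Carrier
    β t = - (y *ᴿ cs (Fin.suc t))
    w≈ : ∀ j → w j ≈ linComb β W j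
    w≈ j = begin
      w j                                     ≈⟨ *-identityˡ _ ⟨
      1# *ᴿ w j                               ≈⟨ *-congʳ (trans (*-comm y c₀) (proj₂ (proj₂ isField c₀ c₀≉0))) ⟨
      (y *ᴿ c₀) *ᴿ w j                        ≈⟨ *-assoc _ _ _ ⟩
      y *ᴿ (c₀ *ᴿ w j)                        ≈⟨ *-congˡ (inverseˡ-unique _ _ (cs≈0 j)) ⟩
      y *ᴿ (- linComb (cs ∘ Fin.suc) W j)     ≈⟨ -‿distribʳ-* _ _ ⟨
      - (y *ᴿ linComb (cs ∘ Fin.suc) W j)     ≈⟨ -‿cong (*-distribˡ-∑ r y _) ⟩
      - ∑ R r (λ t → y *ᴿ (cs (Fin.suc t) *ᴿ W t j)) ≈⟨ ∑-neg r _ ⟨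
      ∑ R r (λ t → - (y *ᴿ (cs (Fin.suc t) *ᴿ W t j)))
        ≈⟨ ∑-cong r (λ t → trans (-‿cong (sym (*-assoc _ _ _))) (-‿distribˡ-* _ _)) ⟩
      linComb β W j                           ∎

  record MaximalIndependentRows {m N : ℕ} (A : Fin m → Vector Carrier N) : Set (c ⊔ ℓ) where
    field
      rank : ℕ
      rows : Fin rank → Fin m
      rows-injective : Injective _≡_ _≡_ rows
      independent : Independent (A ∘ rows)
      spanning : ∀ i → A i ∈Span (A ∘ rows)

  maximalIndependentRows : ∀ {m N} (A : Fin m → Vector Carrier N) → MaximalIndependentRows A
  maximalIndependentRows {zero} A = record
    { rank = 0 ; rows = λ () ; rows-injective = λ {} ; independent = λ _ _ () ; spanning = λ () }
  maximalIndependentRows {suc m} A with maximalIndependentRows (A ∘ Fin.suc)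
  ... | record { rank = r ; rows = rows ; rows-injective = inj ; independent = ind ; spanning = span }
    with ∈Span? (A Fin.zero) (A ∘ Fin.suc ∘ rows)
  ...   | yes A₀∈ = record
    { rank = r
    ; rows = Fin.suc ∘ rows
    ; rows-injective = inj ∘ Fin.suc-injective
    ; independent = ind
    ; spanning = λ { Fin.zero → A₀∈ ; (Fin.suc i) → span i }
    }
  ...   | no A₀∉ = record
    { rank = suc r
    ; rows = Fin.zero V.∷ Fin.suc ∘ rows
    ; rows-injective = λ { {Fin.zero} {Fin.zero} _ → ≡.refl
                         ; {Fin.suc a} {Fin.suc b} e → ≡.cong Fin.suc (inj (Fin.suc-injective e)) }
    ; independent = independent-∷ ind A₀∉
    ; spanning = λ { Fin.zero → ∈Span-head (A Fin.zero) (A ∘ Fin.suc ∘ rows)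
                   ; (Fin.suc i) → ∈Span-∷ (span i) }
    }

module Rank {c ℓ : Level} (R : CommutativeRing c ℓ) where
  open CommutativeRing R renaming (_+_ to _+ᴿ_; _*_ to _*ᴿ_)
  open Span R

  rankAtLeast-≤ : ∀ {m n δ δ′} {M : Matrix R m n} → δ′ ≤ δ → RankAtLeast R δ M → RankAtLeast R δ′ M
  rankAtLeast-≤ δ′≤δ (rows , rows-injective , independent) =
    (λ l → rows (inject≤ l δ′≤δ)) ,
    (λ a b e → Fin.inject≤-injective δ′≤δ δ′≤δ a b (rows-injective _ _ e)) ,
    independent-inject≤ δ′≤δ independent

  rankAtLeast-embed : ∀ {m n m′ n′ δ} {M : Matrix R m n} {C : Matrix R m′ n′}
    (ι : Fin m′ → Fin m) (e : Fin n′ → Fin n) → Injective _≡_ _≡_ ι →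
    (∀ i j → M (ι i) (e j) ≈ C i j) → RankAtLeast R δ C → RankAtLeast R δ M
  rankAtLeast-embed ι e ι-injective M≈C (rows , rows-injective , independent) =
    ι ∘ rows , (λ a b → rows-injective a b ∘ ι-injective) ,
    λ cs cs≈0 → independentOn-embed e (λ _ → tt) (λ l j → M≈C (rows l) j) independent cs (λ j _ → cs≈0 j)

-- Cells of diagrams and proper combinations

injective⇒≤-length : ∀ {a} {A : Set a} {k} (f : Fin k → A) (ys : List A) →
  Injective _≡_ _≡_ f → (∀ i → f i ∈ ys) → k ≤ length ys
injective⇒≤-length f ys f-inj f∈ys = Fin.injective⇒≤ {f = Any.index ∘ f∈ys} λ {i} {i′} e →
  f-inj (≡.trans (Any.lookup-index (f∈ys i)) (≡.trans (≡.cong (lookup ys) e) (≡.sym (Any.lookup-index (f∈ys i′)))))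

lookup-injective : ∀ {a} {A : Set a} {xs : List A} → Unique xs → Injective _≡_ _≡_ (lookup xs)
lookup-injective {xs = x ∷ xs} (x∉ ∷ u) {Fin.zero} {Fin.zero} e = ≡.refl
lookup-injective {xs = x ∷ xs} (x∉ ∷ u) {Fin.zero} {Fin.suc b} e = ⊥-elim (All.lookup x∉ (∈.∈-lookup b) e)
lookup-injective {xs = x ∷ xs} (x∉ ∷ u) {Fin.suc a} {Fin.zero} e = ⊥-elim (All.lookup x∉ (∈.∈-lookup a) (≡.sym e))
lookup-injective {xs = x ∷ xs} (x∉ ∷ u) {Fin.suc a} {Fin.suc b} e = ≡.cong Fin.suc (lookup-injective u e)

rowCells : ℕ → ℕ → Diagram → List (ℕ × ℕ)
rowCells i zero D = []
rowCells i (suc n) D = rowCells i n D ++ᴸ (if D i n then (i , n) ∷ [] else [])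

cells : ℕ → ℕ → Diagram → List (ℕ × ℕ)
cells zero n D = []
cells (suc m) n D = cells m n D ++ᴸ rowCells m n D

length-rowCells : ∀ i n D → length (rowCells i n D) ≡ countRow i n D
length-rowCells i zero D = ≡.refl
length-rowCells i (suc n) D with D i n
... | true = ≡.trans (List.length-++ (rowCells i n D)) (≡.cong (_+ 1) (length-rowCells i n D))
... | false = ≡.trans (List.length-++ (rowCells i n D)) (≡.cong (_+ 0) (length-rowCells i n D))

length-cells : ∀ m n D → length (cells m n D) ≡ card m n D
length-cells zero n D = ≡.refl
length-cells (suc m) n D =
  ≡.trans (List.length-++ (cells m n D)) (≡.cong₂ _+_ (length-cells m n D) (length-rowCells m n D))

∈-rowCells⁻ : ∀ i n D x → x ∈ rowCells i n D → proj₁ x ≡ i × proj₂ x < n × x ∈D D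
∈-rowCells⁻ i (suc n) D x x∈ with ∈.∈-++⁻ (rowCells i n D) x∈
... | inj₁ x∈′ = let (x₁≡i , x₂<n , x∈D) = ∈-rowCells⁻ i n D x x∈′ in x₁≡i , ℕ.m≤n⇒m≤1+n x₂<n , x∈D
... | inj₂ x∈′ with D i n in Dᵢₙ
... | true with x∈′
... | here ≡.refl = ≡.refl , ℕ.≤-refl , Dᵢₙ

∈-cells⁻ : ∀ m n D x → x ∈ cells m n D → proj₁ x < m × proj₂ x < n × x ∈D D
∈-cells⁻ (suc m) n D x x∈ with ∈.∈-++⁻ (cells m n D) x∈
... | inj₁ x∈′ = let (x₁<m , x₂<n , x∈D) = ∈-cells⁻ m n D x x∈′ in ℕ.m≤n⇒m≤1+n x₁<m , x₂<n , x∈D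
... | inj₂ x∈′ = let (x₁≡m , x₂<n , x∈D) = ∈-rowCells⁻ m n D x x∈′ in
  ℕ.≤-reflexive (≡.cong suc x₁≡m) , x₂<n , x∈D

∈-rowCells⁺ : ∀ i n D j → j < n → (i , j) ∈D D → (i , j) ∈ rowCells i n D
∈-rowCells⁺ i (suc n) D j (s≤s j≤n) Dᵢⱼ with ℕ.m≤n⇒m<n∨m≡n j≤n
... | inj₁ j<n = ∈.∈-++⁺ˡ (∈-rowCells⁺ i n D j j<n Dᵢⱼ)
... | inj₂ ≡.refl with D i j | Dᵢⱼ
... | true | _ = ∈.∈-++⁺ʳ (rowCells i j D) (here ≡.refl)

∈-cells⁺ : ∀ m n D i j → i < m → j < n → (i , j) ∈D D → (i , j) ∈ cells m n D
∈-cells⁺ (suc m) n D i j (s≤s i≤m) j<n Dᵢⱼ with ℕ.m≤n⇒m<n∨m≡n i≤m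
... | inj₁ i<m = ∈.∈-++⁺ˡ (∈-cells⁺ m n D i j i<m j<n Dᵢⱼ)
... | inj₂ ≡.refl = ∈.∈-++⁺ʳ (cells i n D) (∈-rowCells⁺ i n D j j<n Dᵢⱼ)

rowCells-unique : ∀ i n D → Unique (rowCells i n D)
rowCells-unique i zero D = []
rowCells-unique i (suc n) D with D i n
... | true = Unique.++⁺ (rowCells-unique i n D) (All.[] ∷ [])
  λ { (x∈ , here ≡.refl) → ℕ.<-irrefl ≡.refl (proj₁ (proj₂ (∈-rowCells⁻ i n D _ x∈))) }
... | false = Unique.++⁺ (rowCells-unique i n D) [] λ { (_ , ()) }

cells-unique : ∀ m n D → Unique (cells m n D)
cells-unique zero n D = []
cells-unique (suc m) n D = Unique.++⁺ (cells-unique m n D) (rowCells-unique m n D)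
  λ (x∈ , x∈′) → ℕ.<-irrefl (proj₁ (∈-rowCells⁻ m n D _ x∈′)) (proj₁ (∈-cells⁻ m n D _ x∈))

Bounded : ℕ → ℕ → Diagram → Set
Bounded m n D = ∀ i j → (i , j) ∈D D → i < m × j < n

module Ferrers {m n : ℕ} {D : Diagram} (ferrers : IsFerrers m n D) where
  bounded : Bounded m n D
  bounded = proj₁ ferrers

  row₀ : ∀ j → j < n → (0 , j) ∈D D
  row₀ = proj₂ (proj₁ (proj₂ (proj₂ (proj₂ ferrers))))

  0<m : 0 < m
  0<m = proj₁ (proj₁ (proj₂ (proj₂ (proj₂ ferrers))))

  lastColumn : ∀ i → i < m → (i , n ∸ 1) ∈D D
  lastColumn = proj₂ (proj₂ (proj₂ (proj₂ (proj₂ ferrers))))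

  0<n : 0 < n
  0<n = proj₁ (proj₂ (proj₂ (proj₂ (proj₂ ferrers))))

  rightClosed : ∀ i {j} j′ → j ≤ j′ → j′ < n → (i , j) ∈D D → (i , j′) ∈D D
  rightClosed i zero z≤n _ p = p
  rightClosed i (suc j′) j≤1+j′ 1+j′<n p with ℕ.m≤n⇒m<n∨m≡n j≤1+j′
  ... | inj₂ ≡.refl = p
  ... | inj₁ (s≤s j≤j′) =
    proj₁ (proj₂ (proj₂ ferrers)) i j′ 1+j′<n (rightClosed i j′ j≤j′ (ℕ.<-trans (ℕ.n<1+n j′) 1+j′<n) p)

cell-≡ : ∀ {D : Diagram} {x y : Cell D} → proj₁ x ≡ proj₁ y → x ≡ y
cell-≡ {x = x , p} {.x , q} ≡.refl = ≡.cong (x ,_) (UIP.Decidable⇒UIP.≡-irrelevant Bool._≟_ p q)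

cellAt : ∀ m n D → Fin (length (cells m n D)) → Cell D
cellAt m n D k = lookup (cells m n D) k , proj₂ (proj₂ (∈-cells⁻ m n D _ (∈.∈-lookup k)))

cellAt-surjective : ∀ {m n D} → Bounded m n D → (y : Cell D) → Σ _ λ k → cellAt m n D k ≡ y
cellAt-surjective {m} {n} {D} bounded ((i , j) , p) =
  Any.index y∈ , cell-≡ (≡.sym (Any.lookup-index y∈))
  where
  y∈ : (i , j) ∈ cells m n D
  y∈ = ∈-cells⁺ m n D i j (proj₁ (bounded i j p)) (proj₂ (bounded i j p)) p

Covered : {D G : Diagram} → (Cell D → Cell G) → ℕ × ℕ → Set
Covered {D} φ x = Σ (Cell D) λ y → proj₁ (φ y) ≡ x

covered? : ∀ {m n D G} → Bounded m n D → (φ : Cell D → Cell G) → ∀ x → Dec (Covered φ x)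
covered? {m} {n} {D} bounded φ x with Fin.any? (λ k → ≡-dec ℕ._≟_ ℕ._≟_ (proj₁ (φ (cellAt m n D k))) x)
... | yes (k , e) = yes (cellAt m n D k , e)
... | no ¬∃ = no λ (y , e) → let (k , k↦y) = cellAt-surjective bounded y in
  ¬∃ (k , ≡.trans (≡.cong (proj₁ ∘ φ) k↦y) e)

-- An uncovered cell of G, together with the images of F₁ and F₂, would give card G + 1 distinct cells of G.
properCombination-covers : ∀ {m₁ n₁ F₁ m₂ n₂ F₂ m n G} →
  Bounded m₁ n₁ F₁ → Bounded m₂ n₂ F₂ → Bounded m n G →
  (pc : IsProperCombination m₁ n₁ F₁ m₂ n₂ F₂ m n G) →
  ∀ x → x ∈D G → Covered (proj₁ pc) x ⊎ Covered (proj₁ (proj₂ pc)) x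
properCombination-covers {m₁} {n₁} {F₁} {m₂} {n₂} {F₂} {m} {n} {G} b₁ b₂ b
  (φ₁ , φ₂ , φ₁-inj , φ₂-inj , φ₁≢φ₂ , card≡ , _) x x∈G
  with covered? b₁ φ₁ x | covered? b₂ φ₂ x
... | yes c | _ = inj₁ c
... | no _ | yes c = inj₂ c
... | no ¬c₁ | no ¬c₂ = ⊥-elim (ℕ.<-irrefl ≡.refl (ℕ.≤-trans (ℕ.≤-reflexive count) too-many))
  where
  k₁ k₂ : ℕ
  k₁ = length (cells m₁ n₁ F₁)
  k₂ = length (cells m₂ n₂ F₂)
  f₁ : Fin k₁ → ℕ × ℕ
  f₁ = proj₁ ∘ φ₁ ∘ cellAt m₁ n₁ F₁
  f₂ : Fin k₂ → ℕ × ℕ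
  f₂ = proj₁ ∘ φ₂ ∘ cellAt m₂ n₂ F₂
  f : Fin (k₁ + (k₂ + 1)) → ℕ × ℕ
  f = f₁ ++ (f₂ ++ λ _ → x)
  f-injective : Injective _≡_ _≡_ f
  f-injective = ++-injective f₁ (f₂ ++ λ _ → x)
    (lookup-injective (cells-unique m₁ n₁ F₁) ∘ φ₁-inj _ _)
    (++-injective f₂ (λ _ → x) (lookup-injective (cells-unique m₂ n₂ F₂) ∘ φ₂-inj _ _)
      (λ { {Fin.zero} {Fin.zero} _ → ≡.refl }) (λ k _ e → ¬c₂ (_ , e)))
    λ k → Fin+-elim (λ k′ e → φ₁≢φ₂ _ _ (≡.trans e (lookup-++ˡ f₂ _ k′)))
                    (λ _ e → ¬c₁ (_ , ≡.trans e (lookup-++ʳ f₂ _ _)))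
  f∈G : ∀ k → f k ∈D G
  f∈G = Fin+-elim (λ k → ≡.subst (_∈D G) (≡.sym (lookup-++ˡ f₁ _ k)) (proj₂ (φ₁ (cellAt m₁ n₁ F₁ k))))
    (Fin+-elim (λ k → ≡.subst (_∈D G) (≡.sym (≡.trans (lookup-++ʳ f₁ _ _) (lookup-++ˡ f₂ _ k)))
                                (proj₂ (φ₂ (cellAt m₂ n₂ F₂ k))))
               (λ k → ≡.subst (_∈D G) (≡.sym (≡.trans (lookup-++ʳ f₁ _ _) (lookup-++ʳ f₂ _ k))) x∈G))
  image∈G : ∀ k → f k ∈ cells m n G
  image∈G k = let (i<m , j<n) = b _ _ (f∈G k) in ∈-cells⁺ m n G _ _ i<m j<n (f∈G k)
  too-many : k₁ + (k₂ + 1) ≤ k₁ + k₂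
  too-many = ℕ.≤-trans (injective⇒≤-length f (cells m n G) f-injective image∈G)
    (ℕ.≤-reflexive (≡.trans (length-cells m n G) (≡.trans (≡.sym card≡)
      (≡.sym (≡.cong₂ _+_ (length-cells m₁ n₁ F₁) (length-cells m₂ n₂ F₂))))))
  count : suc (k₁ + k₂) ≡ k₁ + (k₂ + 1)
  count = ≡.trans (≡.sym (ℕ.+-suc k₁ k₂)) (≡.cong (k₁ +_) (ℕ.+-comm 1 k₂))

-- Line-preserving injections out of a Ferrers diagram

InjectiveOn : ℕ → (ℕ → ℕ) → Set
InjectiveOn m f = ∀ i i′ → i < m → i′ < m → f i ≡ f i′ → i ≡ i′

collinear⇒aligned : ∀ K (X : Fin K → ℕ × ℕ) → (∀ k k′ → SameLine (X k) (X k′)) → ∀ k₀ →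
  (∀ k → proj₁ (X k) ≡ proj₁ (X k₀)) ⊎ (∀ k → proj₂ (X k) ≡ proj₂ (X k₀))
collinear⇒aligned K X collinear k₀ with Fin.all? (λ k → proj₁ (X k) ℕ.≟ proj₁ (X k₀))
... | yes same-row = inj₁ same-row
... | no ¬same-row with Fin.¬∀⟶∃¬ K _ (λ k → proj₁ (X k) ℕ.≟ proj₁ (X k₀)) ¬same-row
... | k₁ , k₁-off = inj₂ λ k → through (collinear k k₀) (collinear k k₁)
  where
  k₁-column : proj₂ (X k₁) ≡ proj₂ (X k₀)
  k₁-column with collinear k₁ k₀
  ... | inj₁ e = ⊥-elim (k₁-off e)
  ... | inj₂ e = e
  through : ∀ {x} → SameLine x (X k₀) → SameLine x (X k₁) → proj₂ x ≡ proj₂ (X k₀)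
  through (inj₂ e) _ = e
  through (inj₁ e) (inj₁ e′) = ⊥-elim (k₁-off (≡.trans (≡.sym e′) e))
  through (inj₁ _) (inj₂ e′) = ≡.trans e′ k₁-column

transpose : Diagram → Diagram
transpose G i j = G j i

transposeCell : ∀ {G} → Cell G → Cell (transpose G)
transposeCell ((a , b) , p) = (b , a) , p

data Shape {D G : Diagram} (m n : ℕ) (φ : Cell D → Cell G) : Set where
  inRow : ∀ g → (∀ i j p → proj₁ (proj₁ (φ ((i , j) , p))) ≡ g) → Shape m n φ
  inColumn : ∀ c → (∀ i j p → proj₂ (proj₁ (φ ((i , j) , p))) ≡ c) → Shape m n φ
  product : ∀ ρ κ → (∀ i j p → proj₁ (φ ((i , j) , p)) ≡ (ρ i , κ j)) →
    InjectiveOn m ρ → InjectiveOn n κ → Shape m n φ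
  transposedProduct : ∀ ρ κ → (∀ i j p → proj₁ (φ ((i , j) , p)) ≡ (κ j , ρ i)) →
    InjectiveOn m ρ → InjectiveOn n κ → Shape m n φ

CellInjective : {D G : Diagram} → (Cell D → Cell G) → Set
CellInjective φ = ∀ x y → proj₁ (φ x) ≡ proj₁ (φ y) → proj₁ x ≡ proj₁ y

module LinePreserving {m n : ℕ} {D G : Diagram} (ferrers : IsFerrers m n D)
  (φ : Cell D → Cell G) (φ-injective : CellInjective φ) (φ-lines : PreservesLines φ) where

  ψ : ∀ i j → (i , j) ∈D D → ℕ × ℕ
  ψ i j p = proj₁ (φ ((i , j) , p))

  ψ-cong : ∀ {i j i′ j′} p p′ → i ≡ i′ → j ≡ j′ → ψ i j p ≡ ψ i′ j′ p′
  ψ-cong p p′ ≡.refl ≡.refl = ≡.cong (proj₁ ∘ φ) (cell-≡ ≡.refl)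

  ψ-injective : ∀ {i j i′ j′} p p′ → ψ i j p ≡ ψ i′ j′ p′ → i ≡ i′ × j ≡ j′
  ψ-injective p p′ e with φ-injective _ _ e
  ... | ≡.refl = ≡.refl , ≡.refl

  ψ-lines : ∀ {i j i′ j′} p p′ → SameLine (i , j) (i′ , j′) → SameLine (ψ i j p) (ψ i′ j′ p′)
  ψ-lines {i} {j} {i′} {j′} p p′ same with ≡-dec ℕ._≟_ ℕ._≟_ (i , j) (i′ , j′)
  ... | yes ≡.refl = inj₁ (≡.cong proj₁ (ψ-cong p p′ ≡.refl ≡.refl))
  ... | no ne = φ-lines _ _ ne same

  open Ferrers ferrers using (bounded; row₀; lastColumn; 0<m; 0<n)

  last : ℕ
  last = n ∸ 1

  last<n : last < n
  last<n = n∸1<n 0<n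

  corner : ℕ × ℕ
  corner = ψ 0 last (row₀ last last<n)

  rowImage : ∀ j → j < n → ℕ × ℕ
  rowImage j j<n = ψ 0 j (row₀ j j<n)

  columnImage : ∀ i → i < m → ℕ × ℕ
  columnImage i i<m = ψ i last (lastColumn i i<m)

  Row₀Horizontal Row₀Vertical LastColumnHorizontal LastColumnVertical : Set
  Row₀Horizontal = ∀ j j<n → proj₁ (rowImage j j<n) ≡ proj₁ corner
  Row₀Vertical = ∀ j j<n → proj₂ (rowImage j j<n) ≡ proj₂ corner
  LastColumnHorizontal = ∀ i i<m → proj₁ (columnImage i i<m) ≡ proj₁ corner
  LastColumnVertical = ∀ i i<m → proj₂ (columnImage i i<m) ≡ proj₂ corner

  row₀-aligned : Row₀Horizontal ⊎ Row₀Vertical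
  row₀-aligned with collinear⇒aligned n (λ k → rowImage (toℕ k) (Fin.toℕ<n k))
                      (λ k k′ → ψ-lines _ _ (inj₁ ≡.refl)) (fromℕ< last<n)
  ... | inj₁ a = inj₁ λ j j<n → ≡.trans (≡.cong proj₁ (ψ-cong _ _ ≡.refl (≡.sym (Fin.toℕ-fromℕ< j<n))))
                                  (≡.trans (a (fromℕ< j<n)) (≡.cong proj₁ (ψ-cong _ _ ≡.refl (Fin.toℕ-fromℕ< last<n))))
  ... | inj₂ a = inj₂ λ j j<n → ≡.trans (≡.cong proj₂ (ψ-cong _ _ ≡.refl (≡.sym (Fin.toℕ-fromℕ< j<n))))
                                  (≡.trans (a (fromℕ< j<n)) (≡.cong proj₂ (ψ-cong _ _ ≡.refl (Fin.toℕ-fromℕ< last<n))))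

  lastColumn-aligned : LastColumnHorizontal ⊎ LastColumnVertical
  lastColumn-aligned with collinear⇒aligned m (λ k → columnImage (toℕ k) (Fin.toℕ<n k))
                            (λ k k′ → ψ-lines _ _ (inj₂ ≡.refl)) (fromℕ< 0<m)
  ... | inj₁ a = inj₁ λ i i<m → ≡.trans (≡.cong proj₁ (ψ-cong _ _ (≡.sym (Fin.toℕ-fromℕ< i<m)) ≡.refl))
                                  (≡.trans (a (fromℕ< i<m)) (≡.cong proj₁ (ψ-cong _ _ (Fin.toℕ-fromℕ< _) ≡.refl)))
  ... | inj₂ a = inj₂ λ i i<m → ≡.trans (≡.cong proj₂ (ψ-cong _ _ (≡.sym (Fin.toℕ-fromℕ< i<m)) ≡.refl))
                                  (≡.trans (a (fromℕ< i<m)) (≡.cong proj₂ (ψ-cong _ _ (Fin.toℕ-fromℕ< _) ≡.refl)))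

  -- The image of (i, j) is collinear with those of (0, j) and (i, last); unless it is their crossing,
  -- one of these two equals the corner, so i ≡ 0 or j ≡ last by injectivity.
  cell-at-crossing : Row₀Horizontal → LastColumnVertical →
    ∀ i j (p : (i , j) ∈D D) →
    ψ i j p ≡ (proj₁ (columnImage i (proj₁ (bounded i j p))) , proj₂ (rowImage j (proj₂ (bounded i j p))))
  cell-at-crossing horizontal vertical i j p =
    crossing (ψ-lines p (row₀ j j<n) (inj₂ ≡.refl)) (ψ-lines p (lastColumn i i<m) (inj₁ ≡.refl))
    where
    i<m : i < m
    i<m = proj₁ (bounded i j p)
    j<n : j < n
    j<n = proj₂ (bounded i j p)
    X : ℕ × ℕ
    X = ψ i j p
    crossing : SameLine X (rowImage j j<n) → SameLine X (columnImage i i<m) →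
      X ≡ (proj₁ (columnImage i i<m) , proj₂ (rowImage j j<n))
    crossing (inj₂ x₂) (inj₁ x₁) = ×-≡,≡→≡ (x₁ , x₂)
    crossing (inj₁ x₁) (inj₁ x₁′) = ×-≡,≡→≡ (x₁′ , ≡.cong proj₂ (ψ-cong p (row₀ j j<n) i≡0 ≡.refl))
      where
      i≡0 : i ≡ 0
      i≡0 = proj₁ (ψ-injective (lastColumn i i<m) _
              (×-≡,≡→≡ (≡.trans (≡.sym x₁′) (≡.trans x₁ (horizontal j j<n)) , vertical i i<m)))
    crossing (inj₂ x₂) (inj₂ x₂′) = ×-≡,≡→≡ (≡.cong proj₁ (ψ-cong p (lastColumn i i<m) ≡.refl j≡last) , x₂)
      where
      j≡last : j ≡ last
      j≡last = proj₂ (ψ-injective (row₀ j j<n) _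
                 (×-≡,≡→≡ (horizontal j j<n , ≡.trans (≡.sym x₂) (≡.trans x₂′ (vertical i i<m)))))
    crossing (inj₁ x₁) (inj₂ x₂′) = ×-≡,≡→≡
      (≡.cong proj₁ (ψ-cong p (lastColumn i i<m) ≡.refl (proj₂ ij)) ,
       ≡.cong proj₂ (ψ-cong p (row₀ j j<n) (proj₁ ij) ≡.refl))
      where
      ij : i ≡ 0 × j ≡ last
      ij = ψ-injective p _ (×-≡,≡→≡ (≡.trans x₁ (horizontal j j<n) , ≡.trans x₂′ (vertical i i<m)))

  cell-in-row : Row₀Horizontal → LastColumnHorizontal → ∀ i j p → proj₁ (ψ i j p) ≡ proj₁ corner
  cell-in-row horizontal horizontal′ i j p =
    along (ψ-lines p (row₀ j j<n) (inj₂ ≡.refl)) (ψ-lines p (lastColumn i i<m) (inj₁ ≡.refl))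
    where
    i<m : i < m
    i<m = proj₁ (bounded i j p)
    j<n : j < n
    j<n = proj₂ (bounded i j p)
    along : SameLine (ψ i j p) (rowImage j j<n) → SameLine (ψ i j p) (columnImage i i<m) →
      proj₁ (ψ i j p) ≡ proj₁ corner
    along (inj₁ x₁) _ = ≡.trans x₁ (horizontal j j<n)
    along _ (inj₁ x₁) = ≡.trans x₁ (horizontal′ i i<m)
    along (inj₂ x₂) (inj₂ x₂′) = ≡.trans (≡.cong proj₁ (ψ-cong p (row₀ j j<n) (≡.sym (proj₁ ij)) ≡.refl))
                                         (horizontal j j<n)
      where
      ij : 0 ≡ i × j ≡ last
      ij = ψ-injective (row₀ j j<n) (lastColumn i i<m)
             (×-≡,≡→≡ (≡.trans (horizontal j j<n) (≡.sym (horizontal′ i i<m)) , ≡.trans (≡.sym x₂) x₂′))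

  ρ : ℕ → ℕ
  ρ i with i ℕ.<? m
  ... | yes i<m = proj₁ (columnImage i i<m)
  ... | no _ = 0

  κ : ℕ → ℕ
  κ j with j ℕ.<? n
  ... | yes j<n = proj₂ (rowImage j j<n)
  ... | no _ = 0

  ρ-columnImage : ∀ i (i<m : i < m) → ρ i ≡ proj₁ (columnImage i i<m)
  ρ-columnImage i i<m with i ℕ.<? m
  ... | yes _ = ≡.cong proj₁ (ψ-cong _ _ ≡.refl ≡.refl)
  ... | no i≮m = ⊥-elim (i≮m i<m)

  κ-rowImage : ∀ j (j<n : j < n) → κ j ≡ proj₂ (rowImage j j<n)
  κ-rowImage j j<n with j ℕ.<? n
  ... | yes _ = ≡.cong proj₂ (ψ-cong _ _ ≡.refl ≡.refl)
  ... | no j≮n = ⊥-elim (j≮n j<n)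

  at-ρκ : Row₀Horizontal → LastColumnVertical → ∀ i j p → ψ i j p ≡ (ρ i , κ j)
  at-ρκ horizontal vertical i j p = ≡.trans (cell-at-crossing horizontal vertical i j p)
    (≡.cong₂ _,_ (≡.sym (ρ-columnImage i _)) (≡.sym (κ-rowImage j _)))

  ρ-injective : LastColumnVertical → InjectiveOn m ρ
  ρ-injective vertical i i′ i<m i′<m e = proj₁ (ψ-injective _ _
    (×-≡,≡→≡ (≡.trans (≡.sym (ρ-columnImage i i<m)) (≡.trans e (ρ-columnImage i′ i′<m)) ,
              ≡.trans (vertical i i<m) (≡.sym (vertical i′ i′<m)))))

  κ-injective : Row₀Horizontal → InjectiveOn n κ
  κ-injective horizontal j j′ j<n j′<n e = proj₂ (ψ-injective _ _
    (×-≡,≡→≡ (≡.trans (horizontal j j<n) (≡.sym (horizontal j′ j′<n)) ,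
              ≡.trans (≡.sym (κ-rowImage j j<n)) (≡.trans e (κ-rowImage j′ j′<n)))))

module _ {m n : ℕ} {D G : Diagram} (ferrers : IsFerrers m n D)
  (φ : Cell D → Cell G) (φ-injective : CellInjective φ) (φ-lines : PreservesLines φ) where
  private
    module L = LinePreserving ferrers φ φ-injective φ-lines
    -- Transposing G handles the two cases in which row 0 is mapped into a column.
    module Lᵀ = LinePreserving ferrers (transposeCell ∘ φ) (λ x y → φ-injective x y ∘ ≡.cong swap)
                  (λ x y x≢y → Sum.swap ∘ φ-lines x y x≢y)

  shape : Shape m n φ
  shape with L.row₀-aligned | L.lastColumn-aligned
  ... | inj₁ horizontal | inj₁ horizontal′ = inRow _ (L.cell-in-row horizontal horizontal′)
  ... | inj₁ horizontal | inj₂ vertical =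
    product L.ρ L.κ (L.at-ρκ horizontal vertical) (L.ρ-injective vertical) (L.κ-injective horizontal)
  ... | inj₂ vertical | inj₂ vertical′ = inColumn _ (Lᵀ.cell-in-row vertical vertical′)
  ... | inj₂ vertical | inj₁ horizontal′ =
    transposedProduct Lᵀ.ρ Lᵀ.κ (λ i j p → ≡.cong swap (Lᵀ.at-ρκ vertical horizontal′ i j p))
      (Lᵀ.ρ-injective horizontal′) (Lᵀ.κ-injective vertical)

≤ᵇ-true : ∀ {a i} → a ≤ i → (a ≤ᵇ i) ≡ true
≤ᵇ-true a≤i = Equivalence.to Bool.T-≡ (ℕ.≤⇒≤ᵇ a≤i)

≤ᵇ-false : ∀ {a i} → i < a → (a ≤ᵇ i) ≡ false
≤ᵇ-false {a} {i} i<a with a ≤ᵇ i in a≤ᵇi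
... | true = ⊥-elim (ℕ.<⇒≱ i<a (ℕ.≤ᵇ⇒≤ a i (≡.subst T (≡.sym a≤ᵇi) tt)))
... | false = ≡.refl

-- Pulling a matrix back along a line-preserving injection

module Matrices {c ℓ : Level} (R : CommutativeRing c ℓ) where
  open CommutativeRing R renaming (_+_ to _+ᴿ_; _*_ to _*ᴿ_)
  open Sums R
  open Span R using (padZero; ∑-padZero)

  ℕMatrix : Set c
  ℕMatrix = ℕ → ℕ → Carrier

  SupportedOn : ∀ {m n} → Diagram → Matrix R m n → Set ℓ
  SupportedOn D C = ∀ i j → D (toℕ i) (toℕ j) ≡ false → C i j ≈ 0#

  extendByZero : ∀ {m n} → Matrix R m n → ℕMatrix
  extendByZero {m} {n} C i j with i ℕ.<? m | j ℕ.<? n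
  ... | yes i<m | yes j<n = C (fromℕ< i<m) (fromℕ< j<n)
  ... | _ | _ = 0#

  extendByZero-toℕ : ∀ {m n} (C : Matrix R m n) i j → extendByZero C (toℕ i) (toℕ j) ≡ C i j
  extendByZero-toℕ {m} {n} C i j with toℕ i ℕ.<? m | toℕ j ℕ.<? n
  ... | yes i<m | yes j<n = ≡.cong₂ C (Fin.fromℕ<-toℕ i i<m) (Fin.fromℕ<-toℕ j j<n)
  ... | no i≮m | _ = ⊥-elim (i≮m (Fin.toℕ<n i))
  ... | yes _ | no j≮n = ⊥-elim (j≮n (Fin.toℕ<n j))

  extendByZero-outsideRows : ∀ {m n} (C : Matrix R m n) i j → ¬ i < m → extendByZero C i j ≡ 0#
  extendByZero-outsideRows {m} {n} C i j i≮m with i ℕ.<? m | j ℕ.<? n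
  ... | yes i<m | _ = ⊥-elim (i≮m i<m)
  ... | no _ | _ = ≡.refl

  extendByZero-comb : ∀ {m n k} (cs : Fin k → Carrier) (B : Fin k → Matrix R m n) i j →
    extendByZero (comb R cs B) i j ≈ ∑ R k (λ l → cs l *ᴿ extendByZero (B l) i j)
  extendByZero-comb {m} {n} {k} cs B i j with i ℕ.<? m | j ℕ.<? n
  ... | yes _ | yes _ = refl
  ... | yes _ | no _ = sym (∑-zero k (λ l → zeroʳ _))
  ... | no _ | _ = sym (∑-zero k (λ l → zeroʳ _))

  extendByZero-support : ∀ {m n} (D : Diagram) (C : Matrix R m n) →
    SupportedOn D C → ∀ i j → D i j ≡ false → extendByZero C i j ≈ 0#
  extendByZero-support {m} {n} D C supported i j Dᵢⱼ with i ℕ.<? m | j ℕ.<? n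
  ... | yes i<m | yes j<n = supported _ _ (≡.trans (≡.cong₂ D (Fin.toℕ-fromℕ< i<m) (Fin.toℕ-fromℕ< j<n)) Dᵢⱼ)
  ... | yes _ | no _ = refl
  ... | no _ | _ = refl

  extendByZero-zero : ∀ {m n} (C : Matrix R m n) → IsZeroMatrix R C → ∀ i j → extendByZero C i j ≈ 0#
  extendByZero-zero {m} {n} C C≈0 i j with i ℕ.<? m | j ℕ.<? n
  ... | yes _ | yes _ = C≈0 _ _
  ... | yes _ | no _ = refl
  ... | no _ | _ = refl

  extendByZero-cong : ∀ {m n} {C C′ : Matrix R m n} → (∀ i j → C i j ≈ C′ i j) →
    ∀ i j → extendByZero C i j ≈ extendByZero C′ i j
  extendByZero-cong {m} {n} C≈C′ i j with i ℕ.<? m | j ℕ.<? n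
  ... | yes _ | yes _ = C≈C′ _ _
  ... | yes _ | no _ = refl
  ... | no _ | _ = refl

  0ᴹ : ∀ {m n} → Matrix R m n
  0ᴹ _ _ = 0#

  comb-++-0ᴹ : ∀ {a b m n} (cs : Fin (a + b) → Carrier) (B : Fin a → Matrix R m n) i j →
    comb R cs (B ++ λ _ → 0ᴹ) i j ≈ comb R (λ t → cs (t ↑ˡ b)) B i j
  comb-++-0ᴹ {a} {b} cs B i j = trans (∑-split a b _) (trans (+-cong
    (∑-cong a (λ t → *-congˡ (reflexive (≡.cong (λ M → M i j) (lookup-++ˡ B (λ (_ : Fin b) → 0ᴹ) t)))))
    (∑-zero b (λ u → trans (*-congˡ (reflexive (≡.cong (λ M → M i j) (lookup-++ʳ B (λ _ → 0ᴹ) u)))) (zeroʳ _))))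
    (+-identityʳ _))

  comb-0ᴹ-++ : ∀ {a b m n} (cs : Fin (a + b) → Carrier) (B : Fin b → Matrix R m n) i j →
    comb R cs ((λ _ → 0ᴹ) ++ B) i j ≈ comb R (λ u → cs (a ↑ʳ u)) B i j
  comb-0ᴹ-++ {a} {b} cs B i j = trans (∑-split a b _) (trans (+-cong
    (∑-zero a (λ t → trans (*-congˡ (reflexive (≡.cong (λ M → M i j) (lookup-++ˡ (λ _ → 0ᴹ) B t)))) (zeroʳ _)))
    (∑-cong b (λ u → *-congˡ (reflexive (≡.cong (λ M → M i j) (lookup-++ʳ {m = a} (λ _ → 0ᴹ) B u))))))
    (+-identityˡ _))

  comb-inject≤ : ∀ {k′ k m n} (h : k′ ≤ k) (cs : Fin k′ → Carrier) (B : Fin k → Matrix R m n) i j →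
    comb R cs (λ t → B (inject≤ t h)) i j ≈ comb R (padZero h cs) B i j
  comb-inject≤ h cs B i j = sym (∑-padZero h cs (λ l → B l i j))

  comb-supported : ∀ {k m n} {D : Diagram} (cs : Fin k → Carrier) {B : Fin k → Matrix R m n} →
    (∀ l → SupportedOn D (B l)) → SupportedOn D (comb R cs B)
  comb-supported {k} cs B-supported i j ¬D = ∑-zero k (λ l → trans (*-congˡ (B-supported l i j ¬D)) (zeroʳ _))

  ++-supported : ∀ {a b m n} {D : Diagram} {B : Fin a → Matrix R m n} {B′ : Fin b → Matrix R m n} →
    (∀ t → SupportedOn D (B t)) → (∀ u → SupportedOn D (B′ u)) → ∀ l → SupportedOn D ((B ++ B′) l)
  ++-supported {B = B} {B′} B-supported B′-supported = Fin+-elim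
    (λ t i j ¬D → trans (reflexive (≡.cong (λ M → M i j) (lookup-++ˡ B B′ t))) (B-supported t i j ¬D))
    (λ u i j ¬D → trans (reflexive (≡.cong (λ M → M i j) (lookup-++ʳ B B′ u))) (B′-supported u i j ¬D))

  shiftMatrix : ℕ → ℕ → ℕMatrix → ℕMatrix
  shiftMatrix a b E i j = if (a ≤ᵇ i) ∧ (b ≤ᵇ j) then E (i ∸ a) (j ∸ b) else 0#

  shiftMatrix-inside : ∀ a b E i j → shiftMatrix a b E (a + i) (b + j) ≡ E i j
  shiftMatrix-inside a b E i j
    rewrite ≤ᵇ-true (ℕ.m≤m+n a i) | ≤ᵇ-true (ℕ.m≤m+n b j) | ℕ.m+n∸m≡n a i | ℕ.m+n∸m≡n b j = ≡.refl

  shiftMatrix-above : ∀ a b E i j → i < a → shiftMatrix a b E i j ≡ 0#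
  shiftMatrix-above a b E i j i<a rewrite ≤ᵇ-false i<a = ≡.refl

  shiftMatrix-left : ∀ a b E i j → j < b → shiftMatrix a b E i j ≡ 0#
  shiftMatrix-left a b E i j j<b rewrite ≤ᵇ-false j<b | Bool.∧-zeroʳ (a ≤ᵇ i) = ≡.refl

  shiftMatrix-zero : ∀ a b E i j → E (i ∸ a) (j ∸ b) ≈ 0# → shiftMatrix a b E i j ≈ 0#
  shiftMatrix-zero a b E i j E≈0 with (a ≤ᵇ i) ∧ (b ≤ᵇ j)
  ... | true = E≈0
  ... | false = refl

  shiftMatrix-support : ∀ (D : Diagram) a b E → (∀ i j → D i j ≡ false → E i j ≈ 0#) →
    ∀ i j → shift D a b i j ≡ false → shiftMatrix a b E i j ≈ 0#
  shiftMatrix-support D a b E supported i j ¬shifted with a ≤ᵇ i | b ≤ᵇ j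
  ... | true | true = supported _ _ ¬shifted
  ... | true | false = refl
  ... | false | _ = refl

  shiftMatrix-cong : ∀ a b {E E′ : ℕMatrix} → (∀ i j → E i j ≈ E′ i j) →
    ∀ i j → shiftMatrix a b E i j ≈ shiftMatrix a b E′ i j
  shiftMatrix-cong a b E≈E′ i j with (a ≤ᵇ i) ∧ (b ≤ᵇ j)
  ... | true = E≈E′ _ _
  ... | false = refl

  shiftMatrix-linComb : ∀ a b {k} (cs : Fin k → Carrier) (E : Fin k → ℕMatrix) i j →
    shiftMatrix a b (λ g h → ∑ R k (λ l → cs l *ᴿ E l g h)) i j ≈ ∑ R k (λ l → cs l *ᴿ shiftMatrix a b (E l) i j)
  shiftMatrix-linComb a b {k} cs E i j with (a ≤ᵇ i) ∧ (b ≤ᵇ j)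
  ... | true = refl
  ... | false = sym (∑-zero k (λ l → zeroʳ _))

module FDCode {c ℓ : Level} (R : CommutativeRing c ℓ) {m n : ℕ} (D : Diagram) {k δ : ℕ}
  (code : FDCodeExists R m n D k δ) where
  open CommutativeRing R
  open Matrices R using (SupportedOn)

  basis : Fin k → Matrix R m n
  basis = proj₁ code

  independent : ∀ cs → IsZeroMatrix R (comb R cs basis) → ∀ l → cs l ≈ 0#
  independent = proj₁ (proj₂ code)

  supported : ∀ l → SupportedOn D (basis l)
  supported = proj₁ (proj₂ (proj₂ code))

  rank : ∀ cs → ¬ IsZeroMatrix R (comb R cs basis) → RankAtLeast R δ (comb R cs basis)
  rank = proj₂ (proj₂ (proj₂ code))

module Pullback {c ℓ : Level} (R : CommutativeRing c ℓ) {m n : ℕ} {D G : Diagram}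
  (ferrers : IsFerrers m n D) (φ : Cell D → Cell G)
  (φ-injective : CellInjective φ) (φ-lines : PreservesLines φ) where
  open CommutativeRing R renaming (_+_ to _+ᴿ_; _*_ to _*ᴿ_)
  open Sums R
  open Span R
  open Matrices R
  open LinePreserving ferrers φ φ-injective φ-lines using (ψ; ψ-cong)
  open Ferrers ferrers using (bounded)
  open SetoidReasoning setoid

  private
    pullbackAt : ℕMatrix → ∀ i j b → D i j ≡ b → Carrier
    pullbackAt E i j true Dᵢⱼ = E (proj₁ (ψ i j Dᵢⱼ)) (proj₂ (ψ i j Dᵢⱼ))
    pullbackAt E i j false _ = 0#

  pullback : ℕMatrix → ℕMatrix
  pullback E i j = pullbackAt E i j (D i j) ≡.refl

  pullback-cell : ∀ E i j (p : (i , j) ∈D D) → pullback E i j ≡ E (proj₁ (ψ i j p)) (proj₂ (ψ i j p))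
  pullback-cell E i j p = at (D i j) ≡.refl
    where
    at : ∀ b (Dᵢⱼ : D i j ≡ b) → pullbackAt E i j b Dᵢⱼ ≡ E (proj₁ (ψ i j p)) (proj₂ (ψ i j p))
    at true Dᵢⱼ = ≡.cong (λ x → E (proj₁ x) (proj₂ x)) (ψ-cong Dᵢⱼ p ≡.refl ≡.refl)
    at false Dᵢⱼ with () ← ≡.trans (≡.sym p) Dᵢⱼ

  pullback-outside : ∀ E i j → D i j ≡ false → pullback E i j ≡ 0#
  pullback-outside E i j ¬Dᵢⱼ = at (D i j) ≡.refl
    where
    at : ∀ b (Dᵢⱼ : D i j ≡ b) → pullbackAt E i j b Dᵢⱼ ≡ 0#
    at true Dᵢⱼ with () ← ≡.trans (≡.sym Dᵢⱼ) ¬Dᵢⱼ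
    at false _ = ≡.refl

  pullback-outsideBox : ∀ E i j → ¬ (i < m × j < n) → pullback E i j ≡ 0#
  pullback-outsideBox E i j outside = pullback-outside E i j (not-cell (D i j) ≡.refl)
    where
    not-cell : ∀ b → D i j ≡ b → D i j ≡ false
    not-cell true Dᵢⱼ = ⊥-elim (outside (bounded i j Dᵢⱼ))
    not-cell false Dᵢⱼ = Dᵢⱼ

  pullback-linComb : ∀ {k} (cs : Fin k → Carrier) (E : Fin k → ℕMatrix) i j →
    pullback (λ g h → ∑ R k (λ l → cs l *ᴿ E l g h)) i j ≈ ∑ R k (λ l → cs l *ᴿ pullback (E l) i j)
  pullback-linComb {k} cs E i j = at (D i j) ≡.refl
    where
    at : ∀ b (Dᵢⱼ : D i j ≡ b) → pullbackAt (λ g h → ∑ R k (λ l → cs l *ᴿ E l g h)) i j b Dᵢⱼ ≈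
                                 ∑ R k (λ l → cs l *ᴿ pullbackAt (E l) i j b Dᵢⱼ)
    at true _ = refl
    at false _ = sym (∑-zero k (λ l → zeroʳ _))

  pullback-cong : ∀ {E E′ : ℕMatrix} → (∀ g h → E g h ≈ E′ g h) → ∀ i j → pullback E i j ≈ pullback E′ i j
  pullback-cong {E} {E′} E≈E′ i j = at (D i j) ≡.refl
    where
    at : ∀ b (Dᵢⱼ : D i j ≡ b) → pullbackAt E i j b Dᵢⱼ ≈ pullbackAt E′ i j b Dᵢⱼ
    at true _ = E≈E′ _ _
    at false _ = refl

  pullback-zero : ∀ {E : ℕMatrix} → (∀ g h → E g h ≈ 0#) → ∀ i j → pullback E i j ≈ 0#
  pullback-zero {E} E≈0 i j = at (D i j) ≡.refl
    where
    at : ∀ b (Dᵢⱼ : D i j ≡ b) → pullbackAt E i j b Dᵢⱼ ≈ 0#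
    at true _ = E≈0 _ _
    at false _ = refl

  masked : ℕMatrix → ℕMatrix
  masked E g h with covered? bounded φ (g , h)
  ... | yes _ = E g h
  ... | no _ = 0#

  masked-covered : ∀ E g h → Covered φ (g , h) → masked E g h ≡ E g h
  masked-covered E g h covered with covered? bounded φ (g , h)
  ... | yes _ = ≡.refl
  ... | no uncovered = ⊥-elim (uncovered covered)

  masked-uncovered : ∀ E g h → ¬ Covered φ (g , h) → masked E g h ≡ 0#
  masked-uncovered E g h uncovered with covered? bounded φ (g , h)
  ... | yes covered = ⊥-elim (uncovered covered)
  ... | no _ = ≡.refl

  masked-cell : ∀ E i j p → masked E (proj₁ (ψ i j p)) (proj₂ (ψ i j p)) ≡ pullback E i j
  masked-cell E i j p = ≡.trans (masked-covered E _ _ (((i , j) , p) , ≡.refl)) (≡.sym (pullback-cell E i j p))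

  pullbackMatrix : ℕMatrix → Matrix R m n
  pullbackMatrix E i j = pullback E (toℕ i) (toℕ j)

  module Rows {N : ℕ} (E : ℕMatrix) where
    private
      A : Matrix R m n
      A = pullbackMatrix E

    maskedRow : ℕ → Vector Carrier N
    maskedRow g h = masked E g (toℕ h)

    MaskedRowsSpannedBy : ℕ → Set (c ⊔ ℓ)
    MaskedRowsSpannedBy r = Σ (Fin r → Vector Carrier N) λ W → ∀ g → maskedRow g ∈Span W

    zeroRows : ∀ {r} → Fin r → Vector Carrier N
    zeroRows _ _ = 0#

    uncovered-row : ∀ g h → (∀ i j p → proj₁ (ψ i j p) ≢ g) → masked E g h ≡ 0#
    uncovered-row g h off = masked-uncovered E g h λ (((i , j) , p) , e) → off i j p (≡.cong proj₁ e)

    uncovered-column : ∀ g h → (∀ i j p → proj₂ (ψ i j p) ≢ h) → masked E g h ≡ 0#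
    uncovered-column g h off = masked-uncovered E g h λ (((i , j) , p) , e) → off i j p (≡.cong proj₂ e)

    masked-zero : (∀ i j → A i j ≈ 0#) → ∀ g h → masked E g h ≈ 0#
    masked-zero A≈0 g h with covered? bounded φ (g , h)
    ... | no _ = refl
    ... | yes (((i , j) , p) , e) = begin
      E g h                                    ≡⟨ ≡.cong (λ x → E (proj₁ x) (proj₂ x)) e ⟨
      E (proj₁ (ψ i j p)) (proj₂ (ψ i j p))    ≡⟨ pullback-cell E i j p ⟨
      pullback E i j                           ≡⟨ ≡.cong₂ (pullback E) (Fin.toℕ-fromℕ< i<m) (Fin.toℕ-fromℕ< j<n) ⟨
      A (fromℕ< i<m) (fromℕ< j<n)              ≈⟨ A≈0 _ _ ⟩
      0#                                       ∎
      where
      i<m : i < m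
      i<m = proj₁ (bounded i j p)
      j<n : j < n
      j<n = proj₂ (bounded i j p)

    -- At an injective labelling of the whole box, uncovered positions are exactly the non-cells of D.
    masked-position : (pos : ℕ → ℕ → ℕ × ℕ) → (∀ i j p → ψ i j p ≡ pos i j) →
      (∀ i j i′ j′ → i < m → j < n → i′ < m → j′ < n → pos i j ≡ pos i′ j′ → i ≡ i′ × j ≡ j′) →
      ∀ (i : Fin m) (j : Fin n) → masked E (proj₁ (pos (toℕ i) (toℕ j))) (proj₂ (pos (toℕ i) (toℕ j))) ≡ A i j
    masked-position pos ψ≡pos pos-injective i j = at (D (toℕ i) (toℕ j)) ≡.refl
      where
      at : ∀ b → D (toℕ i) (toℕ j) ≡ b → masked E (proj₁ (pos (toℕ i) (toℕ j))) (proj₂ (pos (toℕ i) (toℕ j))) ≡ A i j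
      at true Dᵢⱼ = ≡.trans (≡.cong (λ x → masked E (proj₁ x) (proj₂ x)) (≡.sym (ψ≡pos _ _ Dᵢⱼ)))
                      (masked-cell E _ _ Dᵢⱼ)
      at false ¬Dᵢⱼ = ≡.trans (masked-uncovered E _ _ uncovered) (≡.sym (pullback-outside E _ _ ¬Dᵢⱼ))
        where
        uncovered : ¬ Covered φ (pos (toℕ i) (toℕ j))
        uncovered (((i′ , j′) , p) , e) with bounded i′ j′ p
        ... | i′<m , j′<n with pos-injective i′ j′ _ _ i′<m j′<n (Fin.toℕ<n i) (Fin.toℕ<n j)
                                 (≡.trans (≡.sym (ψ≡pos i′ j′ p)) e)
        ... | ≡.refl , ≡.refl with () ← ≡.trans (≡.sym p) ¬Dᵢⱼ

    inRow-span : ∀ r g₀ → (∀ i j p → proj₁ (ψ i j p) ≡ g₀) → MaskedRowsSpannedBy (suc r)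
    inRow-span r g₀ in-row = (maskedRow g₀ V.∷ zeroRows) , spanned
      where
      spanned : ∀ g → maskedRow g ∈Span (maskedRow g₀ V.∷ zeroRows)
      spanned g with g ℕ.≟ g₀
      ... | yes ≡.refl = ∈Span-head (maskedRow g) zeroRows
      ... | no g≢g₀ = ∈Span-zero (maskedRow g₀ V.∷ zeroRows) λ h →
        reflexive (uncovered-row g (toℕ h) λ i j p e → g≢g₀ (≡.trans (≡.sym e) (in-row i j p)))

    inColumn-span : ∀ r h₀ → (∀ i j p → proj₂ (ψ i j p) ≡ h₀) → MaskedRowsSpannedBy (suc r)
    inColumn-span r h₀ in-column = (indicator V.∷ zeroRows) , λ g → (masked E g h₀ V.∷ λ _ → 0#) , entry g
      where
      oneIf : ∀ {h} → Dec (h ≡ h₀) → Carrier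
      oneIf (yes _) = 1#
      oneIf (no _) = 0#
      indicator : Vector Carrier N
      indicator h = oneIf (toℕ h ℕ.≟ h₀)
      entry : ∀ g h → maskedRow g h ≈ masked E g h₀ *ᴿ oneIf (toℕ h ℕ.≟ h₀) +ᴿ linComb (λ _ → 0#) (zeroRows {r}) h
      entry g h with toℕ h ℕ.≟ h₀
      ... | yes ≡.refl = sym (trans (+-congˡ (linComb-zeroˡ (zeroRows {r}) (λ _ → refl) h)) (trans (+-identityʳ _) (*-identityʳ _)))
      ... | no h≢h₀ = trans (reflexive (uncovered-column g (toℕ h) λ i j p e → h≢h₀ (≡.trans (≡.sym e) (in-column i j p))))
        (sym (trans (+-congˡ (linComb-zeroˡ (zeroRows {r}) (λ _ → refl) h)) (trans (+-identityʳ _) (zeroʳ _))))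

    product-span : ∀ {r} (s : Fin r → Fin m) → (∀ i → A i ∈Span (A ∘ s)) → ∀ ρ κ →
      (∀ i j p → ψ i j p ≡ (ρ i , κ j)) → InjectiveOn m ρ → InjectiveOn n κ → MaskedRowsSpannedBy r
    product-span s spanning ρ κ ψ≡ ρ-injective κ-injective = W , spanned
      where
      W = λ t → maskedRow (ρ (toℕ (s t)))
      at : ∀ i j → masked E (ρ (toℕ i)) (κ (toℕ j)) ≡ A i j
      at = masked-position (λ i j → ρ i , κ j) ψ≡
        λ i j i′ j′ i<m j<n i′<m j′<n e →
          ρ-injective i i′ i<m i′<m (≡.cong proj₁ e) , κ-injective j j′ j<n j′<n (≡.cong proj₂ e)
      spanned : ∀ g → maskedRow g ∈Span W
      spanned g with Fin.any? (λ i → ρ (toℕ i) ℕ.≟ g)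
      ... | no ¬row = ∈Span-zero W λ h → reflexive (uncovered-row g (toℕ h) λ i j p e →
        ¬row (fromℕ< (proj₁ (bounded i j p)) ,
              ≡.trans (≡.cong ρ (Fin.toℕ-fromℕ< _)) (≡.trans (≡.sym (≡.cong proj₁ (ψ≡ i j p))) e)))
      ... | yes (i , ρi≡g) = β , entry
        where
        β = proj₁ (spanning i)
        entry : ∀ h → maskedRow g h ≈ linComb β W h
        entry h with Fin.any? (λ j → κ (toℕ j) ℕ.≟ toℕ h)
        ... | no ¬column = trans (reflexive (off g)) (sym (linComb-zeroʳ β W (λ t → reflexive (off _))))
          where
          off : ∀ g′ → masked E g′ (toℕ h) ≡ 0#
          off g′ = uncovered-column g′ (toℕ h) λ i′ j′ p e →
            ¬column (fromℕ< (proj₂ (bounded i′ j′ p)) ,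
                     ≡.trans (≡.cong κ (Fin.toℕ-fromℕ< _)) (≡.trans (≡.sym (≡.cong proj₂ (ψ≡ i′ j′ p))) e))
        ... | yes (j , κj≡h) = begin
          masked E g (toℕ h)                ≡⟨ ≡.cong₂ (masked E) ρi≡g κj≡h ⟨
          masked E (ρ (toℕ i)) (κ (toℕ j))  ≡⟨ at i j ⟩
          A i j                             ≈⟨ proj₂ (spanning i) j ⟩
          linComb β (A ∘ s) j               ≈⟨ ∑-cong _ (λ t → *-congˡ (reflexive
                                                 (≡.trans (≡.sym (at (s t) j)) (≡.cong (masked E _) κj≡h)))) ⟩
          linComb β W h                     ∎

    transposedProduct-span : ∀ {r} (s : Fin r → Fin m) → (∀ i → A i ∈Span (A ∘ s)) → ∀ ρ κ →
      (∀ i j p → ψ i j p ≡ (κ j , ρ i)) → InjectiveOn m ρ → InjectiveOn n κ → MaskedRowsSpannedBy r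
    transposedProduct-span {r} s spanning ρ κ ψ≡ ρ-injective κ-injective = W , spanned
      where
      coefficient : Fin r → ∀ {h} → Dec (∃ λ (i : Fin m) → ρ (toℕ i) ≡ h) → Carrier
      coefficient t (yes (i , _)) = proj₁ (spanning i) t
      coefficient t (no _) = 0#
      W : Fin r → Vector Carrier N
      W t h = coefficient t (Fin.any? (λ i → ρ (toℕ i) ℕ.≟ toℕ h))
      at : ∀ i j → masked E (κ (toℕ j)) (ρ (toℕ i)) ≡ A i j
      at = masked-position (λ i j → κ j , ρ i) ψ≡
        λ i j i′ j′ i<m j<n i′<m j′<n e →
          ρ-injective i i′ i<m i′<m (≡.cong proj₂ e) , κ-injective j j′ j<n j′<n (≡.cong proj₁ e)
      spanned : ∀ g → maskedRow g ∈Span W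
      spanned g with Fin.any? (λ j → κ (toℕ j) ℕ.≟ g)
      ... | no ¬row = ∈Span-zero W λ h → reflexive (uncovered-row g (toℕ h) λ i j p e →
        ¬row (fromℕ< (proj₂ (bounded i j p)) ,
              ≡.trans (≡.cong κ (Fin.toℕ-fromℕ< _)) (≡.trans (≡.sym (≡.cong proj₁ (ψ≡ i j p))) e)))
      ... | yes (j , κj≡g) = (λ t → A (s t) j) , λ h → entry h (Fin.any? (λ i → ρ (toℕ i) ℕ.≟ toℕ h))
        where
        entry : ∀ h column? → maskedRow g h ≈ ∑ R r (λ t → A (s t) j *ᴿ coefficient t column?)
        entry h (no ¬column) = trans (reflexive (uncovered-column g (toℕ h) λ i′ j′ p e →
            ¬column (fromℕ< (proj₁ (bounded i′ j′ p)) ,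
                     ≡.trans (≡.cong ρ (Fin.toℕ-fromℕ< _)) (≡.trans (≡.sym (≡.cong proj₂ (ψ≡ i′ j′ p))) e))))
          (sym (∑-zero r (λ t → zeroʳ _)))
        entry h (yes (i , ρi≡h)) = begin
          masked E g (toℕ h)                          ≡⟨ ≡.cong₂ (masked E) κj≡g ρi≡h ⟨
          masked E (κ (toℕ j)) (ρ (toℕ i))            ≡⟨ at i j ⟩
          A i j                                       ≈⟨ proj₂ (spanning i) j ⟩
          linComb (proj₁ (spanning i)) (A ∘ s) j      ≈⟨ ∑-cong r (λ t → *-comm _ _) ⟩
          ∑ R r (λ t → A (s t) j *ᴿ proj₁ (spanning i) t) ∎

    maskedRows-span : ∀ {r} (s : Fin r → Fin m) → (∀ i → A i ∈Span (A ∘ s)) → MaskedRowsSpannedBy r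
    maskedRows-span {zero} s spanning =
      zeroRows , λ g → ∈Span-zero zeroRows λ h → masked-zero (λ i j → proj₂ (spanning i) j) g (toℕ h)
    maskedRows-span {suc r} s spanning with shape ferrers φ φ-injective φ-lines
    ... | inRow g₀ in-row = inRow-span r g₀ in-row
    ... | inColumn h₀ in-column = inColumn-span r h₀ in-column
    ... | product ρ κ ψ≡ ρ-inj κ-inj = product-span s spanning ρ κ ψ≡ ρ-inj κ-inj
    ... | transposedProduct ρ κ ψ≡ ρ-inj κ-inj = transposedProduct-span s spanning ρ κ ψ≡ ρ-inj κ-inj

module ProperCombination {c ℓ : Level} (R : CommutativeRing c ℓ)
  {m₁ n₁ m₂ n₂ m n : ℕ} {F₁ F₂ G : Diagram}
  (ferrers₁ : IsFerrers m₁ n₁ F₁) (ferrers₂ : IsFerrers m₂ n₂ F₂) (boundedG : Bounded m n G)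
  (combination : IsProperCombination m₁ n₁ F₁ m₂ n₂ F₂ m n G) where
  open CommutativeRing R renaming (_+_ to _+ᴿ_; _*_ to _*ᴿ_)
  open Sums R
  open Matrices R

  private
    φ₁ : Cell F₁ → Cell G
    φ₁ = proj₁ combination
    φ₂ : Cell F₂ → Cell G
    φ₂ = proj₁ (proj₂ combination)
    φ₁≢φ₂ : ∀ x y → proj₁ (φ₁ x) ≢ proj₁ (φ₂ y)
    φ₁≢φ₂ = proj₁ (proj₂ (proj₂ (proj₂ (proj₂ combination))))

  module P₁ = Pullback R ferrers₁ φ₁ (proj₁ (proj₂ (proj₂ combination)))
                (proj₁ (proj₂ (proj₂ (proj₂ (proj₂ (proj₂ (proj₂ combination)))))))
  module P₂ = Pullback R ferrers₂ φ₂ (proj₁ (proj₂ (proj₂ (proj₂ combination))))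
                (proj₂ (proj₂ (proj₂ (proj₂ (proj₂ (proj₂ (proj₂ combination)))))))

  -- Every cell of G is covered by exactly one of the two pieces.
  masked-decomposition : ∀ (C : Matrix R m n) → SupportedOn G C → ∀ g h →
    C g h ≈ P₁.masked (extendByZero C) (toℕ g) (toℕ h) +ᴿ P₂.masked (extendByZero C) (toℕ g) (toℕ h)
  masked-decomposition C supported g h = at (G (toℕ g) (toℕ h)) ≡.refl
    where
    E : ℕMatrix
    E = extendByZero C
    E≡C : E (toℕ g) (toℕ h) ≡ C g h
    E≡C = extendByZero-toℕ C g h
    outside : ∀ {D} (φ : Cell D → Cell G) → G (toℕ g) (toℕ h) ≡ false → ¬ Covered φ (toℕ g , toℕ h)
    outside φ ¬G (x , e) with () ← ≡.trans (≡.sym (≡.subst (_∈D G) e (proj₂ (φ x)))) ¬G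
    at : ∀ b → G (toℕ g) (toℕ h) ≡ b → C g h ≈ P₁.masked E (toℕ g) (toℕ h) +ᴿ P₂.masked E (toℕ g) (toℕ h)
    at false ¬G = trans (supported g h ¬G) (sym (trans
      (+-cong (reflexive (P₁.masked-uncovered E _ _ (outside φ₁ ¬G))) (reflexive (P₂.masked-uncovered E _ _ (outside φ₂ ¬G))))
      (+-identityʳ 0#)))
    at true G∋ with properCombination-covers (proj₁ ferrers₁) (proj₁ ferrers₂) boundedG combination _ G∋
    ... | inj₁ covered₁ = sym (trans
      (+-cong (reflexive (≡.trans (P₁.masked-covered E _ _ covered₁) E≡C))
              (reflexive (P₂.masked-uncovered E _ _ λ covered₂ →
                      φ₁≢φ₂ _ _ (≡.trans (proj₂ covered₁) (≡.sym (proj₂ covered₂))))))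
      (+-identityʳ _))
    ... | inj₂ covered₂ = sym (trans
      (+-cong (reflexive (P₁.masked-uncovered E _ _ λ covered₁ →
                      φ₁≢φ₂ _ _ (≡.trans (proj₂ covered₁) (≡.sym (proj₂ covered₂)))))
              (reflexive (≡.trans (P₂.masked-covered E _ _ covered₂) E≡C)))
      (+-identityˡ _))

module ProperCombinationRank {c ℓ : Level} (R : CommutativeRing c ℓ) (isField : IsField R)
  {q : ℕ} (card : HasCardinality R q)
  {m₁ n₁ m₂ n₂ m n : ℕ} {F₁ F₂ G : Diagram}
  (ferrers₁ : IsFerrers m₁ n₁ F₁) (ferrers₂ : IsFerrers m₂ n₂ F₂) (boundedG : Bounded m n G)
  (combination : IsProperCombination m₁ n₁ F₁ m₂ n₂ F₂ m n G) where
  open CommutativeRing R renaming (_+_ to _+ᴿ_; _*_ to _*ᴿ_)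
  open Span R
  open FiniteField R isField card
  open MaximalIndependentRows
  open Matrices R
  open ProperCombination R ferrers₁ ferrers₂ boundedG combination

  rankOf₁ rankOf₂ : Matrix R m n → ℕ
  rankOf₁ C = rank (maximalIndependentRows (P₁.pullbackMatrix (extendByZero C)))
  rankOf₂ C = rank (maximalIndependentRows (P₂.pullbackMatrix (extendByZero C)))

  -- C is the sum of its two masked pieces, whose rows lie in spans of rankOf₁ C and rankOf₂ C vectors.
  rank≤ : ∀ (C : Matrix R m n) → SupportedOn G C → ∀ {δ} → RankAtLeast R δ C → δ ≤ rankOf₁ C + rankOf₂ C
  rank≤ C supported (rows′ , _ , rows′-independent) = independent-in-span⇒≤ rows′-independent C-rows∈Span
    where
    E : ℕMatrix
    E = extendByZero C
    M₁ : MaximalIndependentRows (P₁.pullbackMatrix E)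
    M₁ = maximalIndependentRows (P₁.pullbackMatrix E)
    M₂ : MaximalIndependentRows (P₂.pullbackMatrix E)
    M₂ = maximalIndependentRows (P₂.pullbackMatrix E)
    S₁ : P₁.Rows.MaskedRowsSpannedBy {N = n} E (rank M₁)
    S₁ = P₁.Rows.maskedRows-span E (rows M₁) (spanning M₁)
    S₂ : P₂.Rows.MaskedRowsSpannedBy {N = n} E (rank M₂)
    S₂ = P₂.Rows.maskedRows-span E (rows M₂) (spanning M₂)
    C-rows∈Span : ∀ l → C (rows′ l) ∈Span (proj₁ S₁ ++ proj₁ S₂)
    C-rows∈Span l = (β₁ ++ β₂) , λ h → trans (masked-decomposition C supported (rows′ l) h)
      (trans (+-cong (proj₂ (proj₂ S₁ (toℕ (rows′ l))) h) (proj₂ (proj₂ S₂ (toℕ (rows′ l))) h))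
             (sym (linComb-++ β₁ β₂ (proj₁ S₁) (proj₁ S₂) h)))
      where
      β₁ : Fin (rank M₁) → Carrier
      β₁ = proj₁ (proj₂ S₁ (toℕ (rows′ l)))
      β₂ : Fin (rank M₂) → Carrier
      β₂ = proj₁ (proj₂ S₂ (toℕ (rows′ l)))

-- The construction

disjointUnion-outside : ∀ {F A B C D} → IsDisjointUnion4 F A B C D → ∀ i j → F i j ≡ false →
  A i j ≡ false × B i j ≡ false × C i j ≡ false × D i j ≡ false
disjointUnion-outside {F} {A} {B} {C} {D} union i j ¬F =
  none (A i j) (B i j) (C i j) (D i j) (≡.trans (≡.sym (union i j)) (≡.cong b2n ¬F))
  where
  none : ∀ a b c d → b2n a + b2n b + b2n c + b2n d ≡ 0 → a ≡ false × b ≡ false × c ≡ false × d ≡ false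
  none false false false false _ = ≡.refl , ≡.refl , ≡.refl , ≡.refl
  none true _ _ _ ()
  none false true _ _ ()
  none false false true _ ()
  none false false false true ()

disjointUnion-disjoint : ∀ {F A B C D} → IsDisjointUnion4 F A B C D → ∀ i j → B i j ≡ true → C i j ≡ true → ⊥
disjointUnion-disjoint {F} {A} {B} {C} {D} union i j =
  twice (F i j) (A i j) (B i j) (C i j) (D i j) (union i j)
  where
  twice : ∀ f a b c d → b2n f ≡ b2n a + b2n b + b2n c + b2n d → b ≡ true → c ≡ true → ⊥
  twice true true true true _ () _ _
  twice true false true true _ () _ _
  twice false true true true _ () _ _
  twice false false true true _ () _ _

shift-∈ : ∀ (S : Diagram) a b i j → S i j ≡ true → shift S a b (a + i) (b + j) ≡ true
shift-∈ S a b i j Sᵢⱼ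
  rewrite ≤ᵇ-true (ℕ.m≤m+n a i) | ≤ᵇ-true (ℕ.m≤m+n b j) | ℕ.m+n∸m≡n a i | ℕ.m+n∸m≡n b j = Sᵢⱼ

module Placement {c ℓ : Level} (R : CommutativeRing c ℓ)
  {m₁ n₁ m₂ n₂ m₃ n₃ m₄ n₄ : ℕ} {F₁ F₂ F₃ F₄ : Diagram}
  (ferrers₁ : IsFerrers m₁ n₁ F₁) (ferrers₂ : IsFerrers m₂ n₂ F₂) (ferrers₄ : IsFerrers m₄ n₄ F₄)
  (m₁+m₂≤m₄ : m₁ + m₂ ≤ m₄) (n₂+n₃≤n₄ : n₂ + n₃ ≤ n₄)
  {F : Diagram}
  (union : IsDisjointUnion4 F F₁ (shift F₂ m₁ n₁) (shift F₄ 0 n₁) (shift F₃ m₄ ((n₁ + n₄) ∸ n₃)))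
  {m₁₂ n₁₂ : ℕ} {F₁₂ : Diagram} (bounded₁₂ : Bounded m₁₂ n₁₂ F₁₂)
  (combination : IsProperCombination m₁ n₁ F₁ m₂ n₂ F₂ m₁₂ n₁₂ F₁₂) where
  open CommutativeRing R renaming (_+_ to _+ᴿ_; _*_ to _*ᴿ_)
  open Sums R
  open Matrices R
  open ProperCombination R ferrers₁ ferrers₂ bounded₁₂ combination using (module P₁; module P₂)
  open SetoidReasoning setoid

  d : ℕ
  d = (n₁ + n₄) ∸ n₃

  place : Matrix R m₁₂ n₁₂ → Matrix R m₃ n₃ → Matrix R m₄ n₄ → ℕMatrix
  place C₁₂ C₃ C₄ x y =
    P₁.pullback (extendByZero C₁₂) x y +ᴿ shiftMatrix m₁ n₁ (P₂.pullback (extendByZero C₁₂)) x y +ᴿ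
    shiftMatrix m₄ d (extendByZero C₃) x y +ᴿ shiftMatrix 0 n₁ (extendByZero C₄) x y

  private
    m₁≤m₄ : m₁ ≤ m₄
    m₁≤m₄ = ℕ.≤-trans (ℕ.m≤m+n m₁ m₂) m₁+m₂≤m₄

    n₁+n₂≤d : n₁ + n₂ ≤ d
    n₁+n₂≤d = ℕ.≤-trans (ℕ.≤-reflexive (≡.sym (ℕ.m+n∸n≡m (n₁ + n₂) n₃)))
      (ℕ.∸-monoˡ-≤ n₃ (ℕ.≤-trans (ℕ.≤-reflexive (ℕ.+-assoc n₁ n₂ n₃)) (ℕ.+-monoʳ-≤ n₁ n₂+n₃≤n₄)))

    n₁≤d : n₁ ≤ d
    n₁≤d = ℕ.≤-trans (ℕ.m≤m+n n₁ n₂) n₁+n₂≤d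

    ≮ : ∀ {x a} → a ≤ x → ¬ x < a
    ≮ a≤x x<a = ℕ.<⇒≱ x<a a≤x

    only₁ : ∀ {a b c e} → b ≈ 0# → c ≈ 0# → e ≈ 0# → a +ᴿ b +ᴿ c +ᴿ e ≈ a
    only₁ b≈0 c≈0 e≈0 = trans (+-cong (+-cong (+-congˡ b≈0) c≈0) e≈0)
      (trans (+-identityʳ _) (trans (+-identityʳ _) (+-identityʳ _)))

    only₂ : ∀ {a b c e} → a ≈ 0# → c ≈ 0# → e ≈ 0# → a +ᴿ b +ᴿ c +ᴿ e ≈ b
    only₂ a≈0 c≈0 e≈0 = trans (+-cong (+-cong (+-congʳ a≈0) c≈0) e≈0)
      (trans (+-identityʳ _) (trans (+-identityʳ _) (+-identityˡ _)))

    only₃ : ∀ {a b c e} → a ≈ 0# → b ≈ 0# → e ≈ 0# → a +ᴿ b +ᴿ c +ᴿ e ≈ c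
    only₃ a≈0 b≈0 e≈0 = trans (+-cong (+-congʳ (+-cong a≈0 b≈0)) e≈0)
      (trans (+-identityʳ _) (trans (+-congʳ (+-identityʳ 0#)) (+-identityˡ _)))

    only₄ : ∀ {a b c e} → a ≈ 0# → b ≈ 0# → c ≈ 0# → a +ᴿ b +ᴿ c +ᴿ e ≈ e
    only₄ a≈0 b≈0 c≈0 = trans (+-congʳ (trans (+-cong (+-cong a≈0 b≈0) c≈0)
      (trans (+-identityʳ _) (+-identityʳ 0#)))) (+-identityˡ _)

    none : ∀ {a b c e} → a ≈ 0# → b ≈ 0# → c ≈ 0# → e ≈ 0# → a +ᴿ b +ᴿ c +ᴿ e ≈ 0#
    none a≈0 b≈0 c≈0 e≈0 = trans (only₄ a≈0 b≈0 c≈0) e≈0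

    *-distribˡ-+₄ : ∀ x a b c e → x *ᴿ (a +ᴿ b +ᴿ c +ᴿ e) ≈ x *ᴿ a +ᴿ x *ᴿ b +ᴿ x *ᴿ c +ᴿ x *ᴿ e
    *-distribˡ-+₄ x a b c e =
      trans (distribˡ x _ e) (+-congʳ (trans (distribˡ x _ c) (+-congʳ (distribˡ x a b))))

    ∑-distrib-+₄ : ∀ k (f g h u : Fin k → Carrier) →
      ∑ R k (λ l → f l +ᴿ g l +ᴿ h l +ᴿ u l) ≈ ∑ R k f +ᴿ ∑ R k g +ᴿ ∑ R k h +ᴿ ∑ R k u
    ∑-distrib-+₄ k f g h u = trans (∑-distrib-+ k _ u)
      (+-congʳ (trans (∑-distrib-+ k _ h) (+-congʳ (∑-distrib-+ k f g))))

  place-cong : ∀ {C₁₂ C₁₂′ C₃ C₃′ C₄ C₄′} →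
    (∀ i j → C₁₂ i j ≈ C₁₂′ i j) → (∀ i j → C₃ i j ≈ C₃′ i j) → (∀ i j → C₄ i j ≈ C₄′ i j) →
    ∀ x y → place C₁₂ C₃ C₄ x y ≈ place C₁₂′ C₃′ C₄′ x y
  place-cong C₁₂≈ C₃≈ C₄≈ x y = +-cong (+-cong (+-cong
    (P₁.pullback-cong (extendByZero-cong C₁₂≈) x y)
    (shiftMatrix-cong m₁ n₁ (P₂.pullback-cong (extendByZero-cong C₁₂≈)) x y))
    (shiftMatrix-cong m₄ d (extendByZero-cong C₃≈) x y))
    (shiftMatrix-cong 0 n₁ (extendByZero-cong C₄≈) x y)

  place-linComb : ∀ {k} (cs : Fin k → Carrier) (A : Fin k → Matrix R m₁₂ n₁₂) (B : Fin k → Matrix R m₃ n₃)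
    (C : Fin k → Matrix R m₄ n₄) x y →
    ∑ R k (λ l → cs l *ᴿ place (A l) (B l) (C l) x y) ≈ place (comb R cs A) (comb R cs B) (comb R cs C) x y
  place-linComb {k} cs A B C x y = begin
    ∑ R k (λ l → cs l *ᴿ place (A l) (B l) (C l) x y) ≈⟨ ∑-cong k (λ l → *-distribˡ-+₄ (cs l) _ _ _ _) ⟩
    _                                                  ≈⟨ ∑-distrib-+₄ k _ _ _ _ ⟩
    _                                                  ≈⟨ +-cong (+-cong (+-cong
                                                            (pullback₁-comb x y)
                                                            (shift-comb m₁ n₁ pullback₂-comb))
                                                            (shift-comb m₄ d (ext-comb B)))
                                                            (shift-comb 0 n₁ (ext-comb C)) ⟩
    place (comb R cs A) (comb R cs B) (comb R cs C) x y ∎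
    where
    ext-comb : ∀ {m n} (M : Fin k → Matrix R m n) g h →
      ∑ R k (λ l → cs l *ᴿ extendByZero (M l) g h) ≈ extendByZero (comb R cs M) g h
    ext-comb M g h = sym (extendByZero-comb cs M g h)
    pullback₁-comb : ∀ g h → ∑ R k (λ l → cs l *ᴿ P₁.pullback (extendByZero (A l)) g h) ≈
                             P₁.pullback (extendByZero (comb R cs A)) g h
    pullback₁-comb g h = trans (sym (P₁.pullback-linComb cs (extendByZero ∘ A) g h)) (P₁.pullback-cong (ext-comb A) g h)
    pullback₂-comb : ∀ g h → ∑ R k (λ l → cs l *ᴿ P₂.pullback (extendByZero (A l)) g h) ≈
                             P₂.pullback (extendByZero (comb R cs A)) g h
    pullback₂-comb g h = trans (sym (P₂.pullback-linComb cs (extendByZero ∘ A) g h)) (P₂.pullback-cong (ext-comb A) g h)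
    shift-comb : ∀ a b {E : Fin k → ℕMatrix} {E′ : ℕMatrix} → (∀ g h → ∑ R k (λ l → cs l *ᴿ E l g h) ≈ E′ g h) →
      ∑ R k (λ l → cs l *ᴿ shiftMatrix a b (E l) x y) ≈ shiftMatrix a b E′ x y
    shift-comb a b {E} E-comb = trans (sym (shiftMatrix-linComb a b cs E x y)) (shiftMatrix-cong a b E-comb x y)

  place-supported : ∀ {C₁₂ C₃ C₄} → SupportedOn F₃ C₃ → SupportedOn F₄ C₄ →
    ∀ x y → F x y ≡ false → place C₁₂ C₃ C₄ x y ≈ 0#
  place-supported {C₁₂} {C₃} {C₄} C₃-supported C₄-supported x y ¬F
    with disjointUnion-outside {F} {F₁} {shift F₂ m₁ n₁} {shift F₄ 0 n₁} {shift F₃ m₄ d} union x y ¬F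
  ... | ¬F₁ , ¬F₂′ , ¬F₄′ , ¬F₃′ = none
    (reflexive (P₁.pullback-outside (extendByZero C₁₂) x y ¬F₁))
    (shiftMatrix-support F₂ m₁ n₁ (P₂.pullback (extendByZero C₁₂))
      (λ i j ¬F₂ → reflexive (P₂.pullback-outside (extendByZero C₁₂) i j ¬F₂)) x y ¬F₂′)
    (shiftMatrix-support F₃ m₄ d (extendByZero C₃) (extendByZero-support F₃ C₃ C₃-supported) x y ¬F₃′)
    (shiftMatrix-support F₄ 0 n₁ (extendByZero C₄) (extendByZero-support F₄ C₄ C₄-supported) x y ¬F₄′)

  -- F₄ is closed to the right, so a cell of F₄ in a row of F₂ + (m₁, n₁) left of its last column would
  -- give F₄ + (0, n₁) a cell on that last column, which lies in F₂ + (m₁, n₁).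
  F₄-avoids-F₂ : ∀ i j → i < m₂ → j < n₂ → F₄ (m₁ + i) j ≡ false
  F₄-avoids-F₂ i j i<m₂ j<n₂ with F₄ (m₁ + i) j in F₄ᵢⱼ
  ... | false = ≡.refl
  ... | true = ⊥-elim (disjointUnion-disjoint {F} {F₁} {shift F₂ m₁ n₁} {shift F₄ 0 n₁} {shift F₃ m₄ d}
      union (m₁ + i) (n₁ + last)
      (shift-∈ F₂ m₁ n₁ i last (Ferrers.lastColumn ferrers₂ i i<m₂))
      (shift-∈ F₄ 0 n₁ (m₁ + i) last (Ferrers.rightClosed ferrers₄ (m₁ + i) last j≤last last<n₄ F₄ᵢⱼ)))
    where
    last = n₂ ∸ 1
    j≤last : j ≤ last
    j≤last = ℕ.∸-monoˡ-≤ 1 j<n₂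
    last<n₄ : last < n₄
    last<n₄ = ℕ.<-≤-trans (n∸1<n (ℕ.≤-<-trans z≤n j<n₂))
                (ℕ.≤-trans (ℕ.m≤m+n n₂ n₃) n₂+n₃≤n₄)

  module _ (C₁₂ : Matrix R m₁₂ n₁₂) (C₃ : Matrix R m₃ n₃) (C₄ : Matrix R m₄ n₄) where
    private
      E₁₂ E₃ E₄ : ℕMatrix
      E₁₂ = extendByZero C₁₂
      E₃ = extendByZero C₃
      E₄ = extendByZero C₄

      F₂-part-below : ∀ x y → m₄ ≤ x → shiftMatrix m₁ n₁ (P₂.pullback E₁₂) x y ≈ 0#
      F₂-part-below x y m₄≤x = shiftMatrix-zero m₁ n₁ (P₂.pullback E₁₂) x y
        (reflexive (P₂.pullback-outsideBox E₁₂ _ _ (≮ m₂≤x∸m₁ ∘ proj₁)))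
        where
        m₂≤x∸m₁ : m₂ ≤ x ∸ m₁
        m₂≤x∸m₁ = ℕ.≤-trans (ℕ.≤-reflexive (≡.sym (ℕ.m+n∸m≡n m₁ m₂)))
          (ℕ.∸-monoˡ-≤ m₁ (ℕ.≤-trans m₁+m₂≤m₄ m₄≤x))

      F₁₂-parts-zero : IsZeroMatrix R C₁₂ → ∀ x y →
        P₁.pullback E₁₂ x y ≈ 0# × shiftMatrix m₁ n₁ (P₂.pullback E₁₂) x y ≈ 0#
      F₁₂-parts-zero C₁₂≈0 x y = P₁.pullback-zero (extendByZero-zero C₁₂ C₁₂≈0) x y ,
        shiftMatrix-zero m₁ n₁ (P₂.pullback E₁₂) x y (P₂.pullback-zero (extendByZero-zero C₁₂ C₁₂≈0) _ _)

    place-F₁ : ∀ x y → x < m₁ → y < n₁ → place C₁₂ C₃ C₄ x y ≈ P₁.pullback E₁₂ x y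
    place-F₁ x y x<m₁ y<n₁ = only₁
      (reflexive (shiftMatrix-above m₁ n₁ (P₂.pullback E₁₂) x y x<m₁))
      (reflexive (shiftMatrix-above m₄ d E₃ x y (ℕ.<-≤-trans x<m₁ m₁≤m₄)))
      (reflexive (shiftMatrix-left 0 n₁ E₄ x y y<n₁))

    place-F₂ : SupportedOn F₄ C₄ → ∀ i j → i < m₂ → j < n₂ →
      place C₁₂ C₃ C₄ (m₁ + i) (n₁ + j) ≈ P₂.pullback E₁₂ i j
    place-F₂ C₄-supported i j i<m₂ j<n₂ = trans (only₂
      (reflexive (P₁.pullback-outsideBox E₁₂ _ _ (≮ (ℕ.m≤m+n m₁ i) ∘ proj₁)))
      (reflexive (shiftMatrix-above m₄ d E₃ _ _ (ℕ.<-≤-trans (ℕ.+-monoʳ-< m₁ i<m₂) m₁+m₂≤m₄)))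
      (trans (reflexive (shiftMatrix-inside 0 n₁ E₄ (m₁ + i) j))
             (extendByZero-support F₄ C₄ C₄-supported (m₁ + i) j (F₄-avoids-F₂ i j i<m₂ j<n₂))))
      (reflexive (shiftMatrix-inside m₁ n₁ (P₂.pullback E₁₂) i j))

    place-F₃ : ∀ i j → place C₁₂ C₃ C₄ (m₄ + i) (d + j) ≈ E₃ i j
    place-F₃ i j = trans (only₃
      (reflexive (P₁.pullback-outsideBox E₁₂ _ _ (≮ (ℕ.≤-trans m₁≤m₄ (ℕ.m≤m+n m₄ i)) ∘ proj₁)))
      (F₂-part-below _ _ (ℕ.m≤m+n m₄ i))
      (shiftMatrix-zero 0 n₁ E₄ _ _ (reflexive (extendByZero-outsideRows C₄ (m₄ + i) _ (≮ (ℕ.m≤m+n m₄ i))))))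
      (reflexive (shiftMatrix-inside m₄ d E₃ i j))

    place-F₄ : IsZeroMatrix R C₁₂ → IsZeroMatrix R C₃ → ∀ x j → place C₁₂ C₃ C₄ x (n₁ + j) ≈ E₄ x j
    place-F₄ C₁₂≈0 C₃≈0 x j = trans (only₄
      (proj₁ (F₁₂-parts-zero C₁₂≈0 _ _))
      (proj₂ (F₁₂-parts-zero C₁₂≈0 _ _))
      (shiftMatrix-zero m₄ d E₃ _ _ (extendByZero-zero C₃ C₃≈0 _ _)))
      (reflexive (shiftMatrix-inside 0 n₁ E₄ x j))

    place-left : ∀ x y → m₁ ≤ x → y < n₁ → place C₁₂ C₃ C₄ x y ≈ 0#
    place-left x y m₁≤x y<n₁ = none
      (reflexive (P₁.pullback-outsideBox E₁₂ x y (≮ m₁≤x ∘ proj₁)))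
      (reflexive (shiftMatrix-left m₁ n₁ (P₂.pullback E₁₂) x y y<n₁))
      (reflexive (shiftMatrix-left m₄ d E₃ x y (ℕ.<-≤-trans y<n₁ n₁≤d)))
      (reflexive (shiftMatrix-left 0 n₁ E₄ x y y<n₁))

    place-belowF₂ : ∀ x y → m₄ ≤ x → y < n₁ + n₂ → place C₁₂ C₃ C₄ x y ≈ 0#
    place-belowF₂ x y m₄≤x y<n₁+n₂ = none
      (reflexive (P₁.pullback-outsideBox E₁₂ x y (≮ (ℕ.≤-trans m₁≤m₄ m₄≤x) ∘ proj₁)))
      (F₂-part-below x y m₄≤x)
      (reflexive (shiftMatrix-left m₄ d E₃ x y (ℕ.<-≤-trans y<n₁+n₂ n₁+n₂≤d)))
      (shiftMatrix-zero 0 n₁ E₄ x y (reflexive (extendByZero-outsideRows C₄ x _ (≮ m₄≤x))))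

    place-zero : IsZeroMatrix R C₁₂ → IsZeroMatrix R C₃ → IsZeroMatrix R C₄ → ∀ x y → place C₁₂ C₃ C₄ x y ≈ 0#
    place-zero C₁₂≈0 C₃≈0 C₄≈0 x y = none
      (proj₁ (F₁₂-parts-zero C₁₂≈0 x y))
      (proj₂ (F₁₂-parts-zero C₁₂≈0 x y))
      (shiftMatrix-zero m₄ d E₃ _ _ (extendByZero-zero C₃ C₃≈0 _ _))
      (shiftMatrix-zero 0 n₁ E₄ _ _ (extendByZero-zero C₄ C₄≈0 _ _))

module Construction {c ℓ : Level} (R : CommutativeRing c ℓ) (isField : IsField R)
  {q : ℕ} (card : HasCardinality R q)
  {m₁ n₁ m₂ n₂ m₃ n₃ m₄ n₄ : ℕ} {F₁ F₂ F₃ F₄ : Diagram}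
  (ferrers₁ : IsFerrers m₁ n₁ F₁) (ferrers₂ : IsFerrers m₂ n₂ F₂) (ferrers₄ : IsFerrers m₄ n₄ F₄)
  (m₁+m₂≤m₄ : m₁ + m₂ ≤ m₄) (n₂+n₃≤n₄ : n₂ + n₃ ≤ n₄)
  {F : Diagram}
  (union : IsDisjointUnion4 F F₁ (shift F₂ m₁ n₁) (shift F₄ 0 n₁) (shift F₃ m₄ ((n₁ + n₄) ∸ n₃)))
  {m₁₂ n₁₂ : ℕ} {F₁₂ : Diagram} (bounded₁₂ : Bounded m₁₂ n₁₂ F₁₂)
  (combination : IsProperCombination m₁ n₁ F₁ m₂ n₂ F₂ m₁₂ n₁₂ F₁₂)
  {k₁ δ₁ k₃ δ₃ k₄ δ₄ : ℕ}
  (code₁₂ : FDCodeExists R m₁₂ n₁₂ F₁₂ k₁ δ₁) (code₃ : FDCodeExists R m₃ n₃ F₃ k₃ δ₃)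
  (code₄ : FDCodeExists R m₄ n₄ F₄ k₄ δ₄) where
  open CommutativeRing R renaming (_+_ to _+ᴿ_; _*_ to _*ᴿ_)
  open Sums R
  open Span R
  open FiniteField R isField card using (_≈?_; maximalIndependentRows; module MaximalIndependentRows)
  open Rank R
  open Matrices R
  open Placement R {m₃ = m₃} {F₃ = F₃} ferrers₁ ferrers₂ ferrers₄ m₁+m₂≤m₄ n₂+n₃≤n₄ union
    bounded₁₂ combination
  open ProperCombination R ferrers₁ ferrers₂ bounded₁₂ combination using (module P₁; module P₂)
  open ProperCombinationRank R isField card ferrers₁ ferrers₂ bounded₁₂ combination
    using (rankOf₁; rankOf₂; rank≤)
  open SetoidReasoning setoid

  m n k : ℕ
  m = m₃ + m₄
  n = n₁ + n₄
  k = k₁ ⊓ k₃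

  private
    module Code₁₂ = FDCode R F₁₂ code₁₂
    module Code₃ = FDCode R F₃ code₃
    module Code₄ = FDCode R F₄ code₄
    B₁₂ : Fin k₁ → Matrix R m₁₂ n₁₂
    B₁₂ = Code₁₂.basis
    B₃ : Fin k₃ → Matrix R m₃ n₃
    B₃ = Code₃.basis
    B₄ : Fin k₄ → Matrix R m₄ n₄
    B₄ = Code₄.basis
    k≤k₁ : k ≤ k₁
    k≤k₁ = ℕ.m⊓n≤m k₁ k₃
    k≤k₃ : k ≤ k₃
    k≤k₃ = ℕ.m⊓n≤n k₁ k₃

  -- Basis matrix t ↑ˡ k₄ places (B₁₂ t, B₃ t, 0) and k ↑ʳ u places (0, 0, B₄ u), so a coefficient
  -- vector's first k entries are shared by the F₁₂- and the F₃-codeword.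
  parts₁₂ : Fin (k + k₄) → Matrix R m₁₂ n₁₂
  parts₁₂ = (λ t → B₁₂ (inject≤ t k≤k₁)) ++ λ _ → 0ᴹ

  parts₃ : Fin (k + k₄) → Matrix R m₃ n₃
  parts₃ = (λ t → B₃ (inject≤ t k≤k₃)) ++ λ _ → 0ᴹ

  parts₄ : Fin (k + k₄) → Matrix R m₄ n₄
  parts₄ = (λ _ → 0ᴹ) ++ B₄

  basis : Fin (k + k₄) → Matrix R m n
  basis l i j = place (parts₁₂ l) (parts₃ l) (parts₄ l) (toℕ i) (toℕ j)

  basis-supported : ∀ l → SupportedOn F (basis l)
  basis-supported l i j = place-supported
    (++-supported {D = F₃} (λ t → Code₃.supported (inject≤ t k≤k₃)) (λ _ _ _ _ → refl) l)
    (++-supported {D = F₄} (λ _ _ _ _ → refl) Code₄.supported l) (toℕ i) (toℕ j)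

  module Codeword (cs : Fin (k + k₄) → Carrier) where
    shared : Fin k → Carrier
    shared t = cs (t ↑ˡ k₄)

    codeword₁₂ : Matrix R m₁₂ n₁₂
    codeword₁₂ = comb R (padZero k≤k₁ shared) B₁₂

    codeword₃ : Matrix R m₃ n₃
    codeword₃ = comb R (padZero k≤k₃ shared) B₃

    codeword₄ : Matrix R m₄ n₄
    codeword₄ = comb R (λ u → cs (k ↑ʳ u)) B₄

    comb-basis : ∀ i j → comb R cs basis i j ≈ place codeword₁₂ codeword₃ codeword₄ (toℕ i) (toℕ j)
    comb-basis i j = trans (place-linComb cs parts₁₂ parts₃ parts₄ _ _) (place-cong
      (λ g h → trans (comb-++-0ᴹ {k} {k₄} cs (λ t → B₁₂ (inject≤ t k≤k₁)) g h) (comb-inject≤ k≤k₁ shared B₁₂ g h))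
      (λ g h → trans (comb-++-0ᴹ {k} {k₄} cs (λ t → B₃ (inject≤ t k≤k₃)) g h) (comb-inject≤ k≤k₃ shared B₃ g h))
      (comb-0ᴹ-++ {k} {k₄} cs B₄) _ _)

    comb-basis-at : ∀ {x y} (x<m : x < m) (y<n : y < n) →
      comb R cs basis (fromℕ< x<m) (fromℕ< y<n) ≈ place codeword₁₂ codeword₃ codeword₄ x y
    comb-basis-at x<m y<n = trans (comb-basis _ _)
      (reflexive (≡.cong₂ (place codeword₁₂ codeword₃ codeword₄) (Fin.toℕ-fromℕ< x<m) (Fin.toℕ-fromℕ< y<n)))

    shared-zero : (∀ t → shared t ≈ 0#) → IsZeroMatrix R codeword₁₂ × IsZeroMatrix R codeword₃
    shared-zero shared≈0 = (λ i j → via k≤k₁ (λ l → B₁₂ l i j)) , (λ i j → via k≤k₃ (λ l → B₃ l i j))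
      where
      via : ∀ {k′} (h : k ≤ k′) (g : Fin k′ → Carrier) → ∑ R k′ (λ l → padZero h shared l *ᴿ g l) ≈ 0#
      via h g = trans (∑-padZero h shared g) (∑-zero k (λ t → trans (*-congʳ (shared≈0 t)) (zeroˡ _)))

  private
    n₃≤n : n₃ ≤ n
    n₃≤n = ℕ.≤-trans (ℕ.≤-trans (ℕ.m≤n+m n₃ n₂) n₂+n₃≤n₄) (ℕ.m≤n+m n₄ n₁)

    m₄≤m : m₄ ≤ m
    m₄≤m = ℕ.m≤n+m m₄ m₃

    row₁ : ∀ (i : Fin m₁) → toℕ i < m
    row₁ i = ℕ.<-≤-trans (Fin.toℕ<n i) (ℕ.≤-trans (ℕ.≤-trans (ℕ.m≤m+n m₁ m₂) m₁+m₂≤m₄) m₄≤m)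

    column₁ : ∀ (j : Fin n₁) → toℕ j < n
    column₁ j = ℕ.<-≤-trans (Fin.toℕ<n j) (ℕ.m≤m+n n₁ n₄)

    row₂ : ∀ (i : Fin m₂) → m₁ + toℕ i < m
    row₂ i = ℕ.<-≤-trans (ℕ.+-monoʳ-< m₁ (Fin.toℕ<n i)) (ℕ.≤-trans m₁+m₂≤m₄ m₄≤m)

    column₂ : ∀ (j : Fin n₂) → n₁ + toℕ j < n
    column₂ j = ℕ.+-monoʳ-< n₁ (ℕ.<-≤-trans (Fin.toℕ<n j) (ℕ.≤-trans (ℕ.m≤m+n n₂ n₃) n₂+n₃≤n₄))

    row₃ : ∀ (i : Fin m₃) → m₄ + toℕ i < m
    row₃ i = ≡.subst (m₄ + toℕ i <_) (ℕ.+-comm m₄ m₃) (ℕ.+-monoʳ-< m₄ (Fin.toℕ<n i))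

    column₃ : ∀ (j : Fin n₃) → d + toℕ j < n
    column₃ j = ≡.subst (d + toℕ j <_) (ℕ.m∸n+n≡m n₃≤n) (ℕ.+-monoʳ-< d (Fin.toℕ<n j))

    row₄ : ∀ (i : Fin m₄) → toℕ i < m
    row₄ i = ℕ.<-≤-trans (Fin.toℕ<n i) m₄≤m

    column₄ : ∀ (j : Fin n₄) → n₁ + toℕ j < n
    column₄ j = ℕ.+-monoʳ-< n₁ (Fin.toℕ<n j)

  basis-independent : ∀ cs → IsZeroMatrix R (comb R cs basis) → ∀ l → cs l ≈ 0#
  basis-independent cs cs-zero = Fin+-elim shared≈0 own≈0
    where
    open Codeword cs
    codeword₃≈0 : IsZeroMatrix R codeword₃
    codeword₃≈0 i j = begin
      codeword₃ i j                                                ≡⟨ extendByZero-toℕ codeword₃ i j ⟨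
      extendByZero codeword₃ (toℕ i) (toℕ j)                       ≈⟨ place-F₃ codeword₁₂ codeword₃ codeword₄ _ _ ⟨
      place codeword₁₂ codeword₃ codeword₄ (m₄ + toℕ i) (d + toℕ j) ≈⟨ comb-basis-at (row₃ i) (column₃ j) ⟨
      comb R cs basis _ _                                          ≈⟨ cs-zero _ _ ⟩
      0#                                                           ∎
    shared≈0 : ∀ t → shared t ≈ 0#
    shared≈0 t = trans (reflexive (≡.sym (padZero-inject≤ k≤k₃ shared t)))
      (Code₃.independent (padZero k≤k₃ shared) codeword₃≈0 (inject≤ t k≤k₃))
    codeword₄≈0 : IsZeroMatrix R codeword₄
    codeword₄≈0 i j = begin
      codeword₄ i j                                              ≡⟨ extendByZero-toℕ codeword₄ i j ⟨
      extendByZero codeword₄ (toℕ i) (toℕ j)                     ≈⟨ place-F₄ codeword₁₂ codeword₃ codeword₄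
                                                                     (proj₁ (shared-zero shared≈0)) (proj₂ (shared-zero shared≈0)) _ _ ⟨
      place codeword₁₂ codeword₃ codeword₄ (toℕ i) (n₁ + toℕ j)  ≈⟨ comb-basis-at (row₄ i) (column₄ j) ⟨
      comb R cs basis _ _                                        ≈⟨ cs-zero _ _ ⟩
      0#                                                         ∎
    own≈0 : ∀ u → cs (k ↑ʳ u) ≈ 0#
    own≈0 = Code₄.independent (λ u → cs (k ↑ʳ u)) codeword₄≈0

  private
    fromℕ<-injective : ∀ {a N} (f : Fin a → ℕ) (bound : ∀ x → f x < N) →
      (∀ {x y} → f x ≡ f y → x ≡ y) → ∀ {x y} → fromℕ< (bound x) ≡ fromℕ< (bound y) → x ≡ y
    fromℕ<-injective f bound f-injective e =
      f-injective (≡.trans (≡.sym (Fin.toℕ-fromℕ< (bound _))) (≡.trans (≡.cong toℕ e) (Fin.toℕ-fromℕ< (bound _))))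

  rank-via-F₄ : ∀ cs → (∀ t → Codeword.shared cs t ≈ 0#) → ¬ IsZeroMatrix R (comb R cs basis) →
    RankAtLeast R δ₄ (comb R cs basis)
  rank-via-F₄ cs shared≈0 nonzero =
    rankAtLeast-embed {M = comb R cs basis} (λ i → fromℕ< (row₄ i)) (λ j → fromℕ< (column₄ j))
      (fromℕ<-injective toℕ row₄ Fin.toℕ-injective) value
      (Code₄.rank (λ u → cs (k ↑ʳ u)) codeword₄≉0)
    where
    open Codeword cs
    codeword₁₂≈0 : IsZeroMatrix R codeword₁₂
    codeword₁₂≈0 = proj₁ (shared-zero shared≈0)
    codeword₃≈0 : IsZeroMatrix R codeword₃
    codeword₃≈0 = proj₂ (shared-zero shared≈0)
    value : ∀ i j → comb R cs basis (fromℕ< (row₄ i)) (fromℕ< (column₄ j)) ≈ codeword₄ i j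
    value i j = trans (comb-basis-at (row₄ i) (column₄ j))
      (trans (place-F₄ codeword₁₂ codeword₃ codeword₄ codeword₁₂≈0 codeword₃≈0 _ _)
             (reflexive (extendByZero-toℕ codeword₄ i j)))
    codeword₄≉0 : ¬ IsZeroMatrix R codeword₄
    codeword₄≉0 codeword₄≈0 = nonzero λ i j → trans (comb-basis i j)
      (place-zero codeword₁₂ codeword₃ codeword₄ codeword₁₂≈0 codeword₃≈0 codeword₄≈0 _ _)

  InF₁Columns InF₂Columns InF₃Columns : Fin n → Set
  InF₁Columns j = toℕ j < n₁
  InF₂Columns j = n₁ ≤ toℕ j × toℕ j < n₁ + n₂
  InF₃Columns j = d ≤ toℕ j

  module SharedRows (cs : Fin (k + k₄) → Carrier) (t₀ : Fin k) (t₀≉0 : ¬ Codeword.shared cs t₀ ≈ 0#) where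
    open Codeword cs
    private
      E : ℕMatrix
      E = extendByZero codeword₁₂
      module M₁ = MaximalIndependentRows (maximalIndependentRows (P₁.pullbackMatrix E))
      module M₂ = MaximalIndependentRows (maximalIndependentRows (P₂.pullbackMatrix E))

    codeword₁₂≉0 : ¬ IsZeroMatrix R codeword₁₂
    codeword₁₂≉0 codeword₁₂≈0 = t₀≉0 (trans (reflexive (≡.sym (padZero-inject≤ k≤k₁ shared t₀)))
      (Code₁₂.independent (padZero k≤k₁ shared) codeword₁₂≈0 (inject≤ t₀ k≤k₁)))

    codeword₃≉0 : ¬ IsZeroMatrix R codeword₃
    codeword₃≉0 codeword₃≈0 = t₀≉0 (trans (reflexive (≡.sym (padZero-inject≤ k≤k₃ shared t₀)))
      (Code₃.independent (padZero k≤k₃ shared) codeword₃≈0 (inject≤ t₀ k≤k₃)))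

    private
      rank₃ : RankAtLeast R δ₃ codeword₃
      rank₃ = Code₃.rank (padZero k≤k₃ shared) codeword₃≉0
      r₃ : Fin δ₃ → Fin m₃
      r₃ = proj₁ rank₃

    rows₁ : Fin M₁.rank → Fin m
    rows₁ l = fromℕ< (row₁ (M₁.rows l))

    rows₂ : Fin M₂.rank → Fin m
    rows₂ l = fromℕ< (row₂ (M₂.rows l))

    rows₃ : Fin δ₃ → Fin m
    rows₃ l = fromℕ< (row₃ (r₃ l))

    rows : Fin (M₁.rank + (M₂.rank + δ₃)) → Fin m
    rows = rows₁ ++ (rows₂ ++ rows₃)

    private
      M : Matrix R m n
      M = comb R cs basis

      at-rows₁ : ∀ l j → M (rows₁ l) (fromℕ< (column₁ j)) ≈ P₁.pullbackMatrix E (M₁.rows l) j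
      at-rows₁ l j = trans (comb-basis-at (row₁ (M₁.rows l)) (column₁ j))
        (place-F₁ codeword₁₂ codeword₃ codeword₄ _ _ (Fin.toℕ<n (M₁.rows l)) (Fin.toℕ<n j))

      at-rows₂ : ∀ l j → M (rows₂ l) (fromℕ< (column₂ j)) ≈ P₂.pullbackMatrix E (M₂.rows l) j
      at-rows₂ l j = trans (comb-basis-at (row₂ (M₂.rows l)) (column₂ j))
        (place-F₂ codeword₁₂ codeword₃ codeword₄ (comb-supported {D = F₄} _ (Code₄.supported)) _ _
          (Fin.toℕ<n (M₂.rows l)) (Fin.toℕ<n j))

      at-rows₃ : ∀ l j → M (rows₃ l) (fromℕ< (column₃ j)) ≈ codeword₃ (r₃ l) j
      at-rows₃ l j = trans (comb-basis-at (row₃ (r₃ l)) (column₃ j))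
        (trans (place-F₃ codeword₁₂ codeword₃ codeword₄ _ _) (reflexive (extendByZero-toℕ codeword₃ _ j)))

      toℕ-rows₂₃ : ∀ l → m₁ ≤ toℕ ((rows₂ ++ rows₃) l)
      toℕ-rows₂₃ = Fin+-elim
        (λ l → ≡.subst (m₁ ≤_) (≡.sym (≡.trans (≡.cong toℕ (lookup-++ˡ rows₂ rows₃ l)) (Fin.toℕ-fromℕ< _)))
                 (ℕ.m≤m+n m₁ _))
        (λ l → ≡.subst (m₁ ≤_) (≡.sym (≡.trans (≡.cong toℕ (lookup-++ʳ rows₂ rows₃ l)) (Fin.toℕ-fromℕ< _)))
                 (ℕ.≤-trans (ℕ.≤-trans (ℕ.m≤m+n m₁ m₂) m₁+m₂≤m₄) (ℕ.m≤m+n m₄ _)))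

    rows-independent : IndependentOn (λ _ → ⊤) (M ∘ rows)
    rows-independent = independentOn-++ {P = InF₁Columns} {Q = λ j → InF₂Columns j ⊎ InF₃Columns j} M rows₁ (rows₂ ++ rows₃)
      (independentOn-embed (λ j → fromℕ< (column₁ j)) in₁ at-rows₁ M₁.independent)
      (independentOn-++ {P = InF₂Columns} {Q = InF₃Columns} M rows₂ rows₃
        (independentOn-embed (λ j → fromℕ< (column₂ j)) in₂ at-rows₂ M₂.independent)
        (independentOn-embed (λ j → fromℕ< (column₃ j)) in₃ at-rows₃ (proj₂ (proj₂ rank₃)))
        (λ l j (_ , j<n₁+n₂) → trans (comb-basis (rows₃ l) j)
          (place-belowF₂ codeword₁₂ codeword₃ codeword₄ _ _
            (≡.subst (m₄ ≤_) (≡.sym (Fin.toℕ-fromℕ< _)) (ℕ.m≤m+n m₄ _)) j<n₁+n₂))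
        (λ _ → inj₁) (λ _ → inj₂))
      (λ l j j<n₁ → trans (comb-basis _ j) (place-left codeword₁₂ codeword₃ codeword₄ _ _ (toℕ-rows₂₃ l) j<n₁))
      (λ _ _ → tt) (λ _ _ → tt)
      where
      in₁ : ∀ j → InF₁Columns (fromℕ< (column₁ j))
      in₁ j = ≡.subst (_< n₁) (≡.sym (Fin.toℕ-fromℕ< _)) (Fin.toℕ<n j)
      in₂ : ∀ j → InF₂Columns (fromℕ< (column₂ j))
      in₂ j rewrite Fin.toℕ-fromℕ< (column₂ j) = ℕ.m≤m+n n₁ _ , ℕ.+-monoʳ-< n₁ (Fin.toℕ<n j)
      in₃ : ∀ j → InF₃Columns (fromℕ< (column₃ j))
      in₃ j = ≡.subst (d ≤_) (≡.sym (Fin.toℕ-fromℕ< _)) (ℕ.m≤m+n d _)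

    rows-injective : Injective _≡_ _≡_ rows
    rows-injective = ++-injective rows₁ (rows₂ ++ rows₃)
      (fromℕ<-injective _ (row₁ ∘ M₁.rows) (M₁.rows-injective ∘ Fin.toℕ-injective))
      (++-injective rows₂ rows₃
        (fromℕ<-injective _ (row₂ ∘ M₂.rows) (M₂.rows-injective ∘ Fin.toℕ-injective ∘ ℕ.+-cancelˡ-≡ m₁ _ _))
        (fromℕ<-injective _ (row₃ ∘ r₃) (proj₁ (proj₂ rank₃) _ _ ∘ Fin.toℕ-injective ∘ ℕ.+-cancelˡ-≡ m₄ _ _))
        λ l l′ e → ℕ.<⇒≱ (rows₂<m₄ l) (≡.subst (m₄ ≤_) (≡.cong toℕ (≡.sym e)) (m₄≤rows₃ l′)))
      λ l l′ e → ℕ.<⇒≱ (rows₁<m₁ l) (≡.subst (m₁ ≤_) (≡.cong toℕ (≡.sym e)) (toℕ-rows₂₃ l′))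
      where
      rows₁<m₁ : ∀ l → toℕ (rows₁ l) < m₁
      rows₁<m₁ l = ≡.subst (_< m₁) (≡.sym (Fin.toℕ-fromℕ< _)) (Fin.toℕ<n (M₁.rows l))
      rows₂<m₄ : ∀ l → toℕ (rows₂ l) < m₄
      rows₂<m₄ l = ≡.subst (_< m₄) (≡.sym (Fin.toℕ-fromℕ< _))
        (ℕ.<-≤-trans (ℕ.+-monoʳ-< m₁ (Fin.toℕ<n (M₂.rows l))) m₁+m₂≤m₄)
      m₄≤rows₃ : ∀ l → m₄ ≤ toℕ (rows₃ l)
      m₄≤rows₃ l = ≡.subst (m₄ ≤_) (≡.sym (Fin.toℕ-fromℕ< _)) (ℕ.m≤m+n m₄ _)

    rank-via-shared : RankAtLeast R (rankOf₁ codeword₁₂ + (rankOf₂ codeword₁₂ + δ₃)) (comb R cs basis)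
    rank-via-shared = rows , (λ _ _ → rows-injective) , λ cs′ cs′≈0 → rows-independent cs′ (λ j _ → cs′≈0 j)

  codeword-rank : ∀ cs → ¬ IsZeroMatrix R (comb R cs basis) → RankAtLeast R ((δ₁ + δ₃) ⊓ δ₄) (comb R cs basis)
  codeword-rank cs nonzero with Fin.all? (λ t → Codeword.shared cs t ≈? 0#)
  ... | yes shared≈0 = rankAtLeast-≤ {M = comb R cs basis} (ℕ.m⊓n≤n _ _) (rank-via-F₄ cs shared≈0 nonzero)
  ... | no ¬shared≈0 with Fin.¬∀⟶∃¬ k _ (λ t → Codeword.shared cs t ≈? 0#) ¬shared≈0
  ... | t₀ , t₀≉0 = rankAtLeast-≤ {M = comb R cs basis} (ℕ.≤-trans (ℕ.m⊓n≤m _ _) δ₁+δ₃≤) rank-via-shared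
    where
    open Codeword cs
    open SharedRows cs t₀ t₀≉0
    δ₁≤ : δ₁ ≤ rankOf₁ codeword₁₂ + rankOf₂ codeword₁₂
    δ₁≤ = rank≤ codeword₁₂ (comb-supported {D = F₁₂} (padZero k≤k₁ shared) (Code₁₂.supported))
      (Code₁₂.rank (padZero k≤k₁ shared) codeword₁₂≉0)
    δ₁+δ₃≤ : δ₁ + δ₃ ≤ rankOf₁ codeword₁₂ + (rankOf₂ codeword₁₂ + δ₃)
    δ₁+δ₃≤ = ℕ.≤-trans (ℕ.+-monoˡ-≤ δ₃ δ₁≤)
      (ℕ.≤-reflexive (ℕ.+-assoc (rankOf₁ codeword₁₂) (rankOf₂ codeword₁₂) δ₃))

mainTheorem5 : ∀ {c ℓ : Level} (q : ℕ) → IsPrimePower q →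
    (R : CommutativeRing c ℓ) → IsFiniteField R q →
    (m₁ n₁ m₂ n₂ m₃ n₃ m₄ n₄ : ℕ) (F₁ F₂ F₃ F₄ : Diagram) →
    IsFerrers m₁ n₁ F₁ → IsFerrers m₂ n₂ F₂ →
    IsFerrers m₃ n₃ F₃ → IsFerrers m₄ n₄ F₄ →
    m₁ + m₂ ≤ m₄ → n₂ + n₃ ≤ n₄ →
    (F : Diagram) → IsFerrers (m₃ + m₄) (n₁ + n₄) F →
    IsDisjointUnion4 F F₁ (shift F₂ m₁ n₁) (shift F₄ 0 n₁)
      (shift F₃ m₄ ((n₁ + n₄) ∸ n₃)) →
    (m₁₂ n₁₂ : ℕ) (F₁₂ : Diagram) → IsFerrers m₁₂ n₁₂ F₁₂ →
    IsProperCombination m₁ n₁ F₁ m₂ n₂ F₂ m₁₂ n₁₂ F₁₂ →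
    (k₁ δ₁ k₃ δ₃ k₄ δ₄ : ℕ) →
    FDCodeExists R m₁₂ n₁₂ F₁₂ k₁ δ₁ →
    FDCodeExists R m₃ n₃ F₃ k₃ δ₃ →
    FDCodeExists R m₄ n₄ F₄ k₄ δ₄ →
    FDCodeExists R (m₃ + m₄) (n₁ + n₄) F ((k₁ ⊓ k₃) + k₄) ((δ₁ + δ₃) ⊓ δ₄)
mainTheorem5 _ _ R (isField , card) _ _ _ _ _ _ _ _ _ _ F₃ _ ferrers₁ ferrers₂ _ ferrers₄ m₁+m₂≤m₄ n₂+n₃≤n₄
  _ _ union _ _ _ ferrers₁₂ combination _ _ _ _ _ _ code₁₂ code₃ code₄ =
  basis , basis-independent , basis-supported , codeword-rank
  where
  open Construction R isField card {F₃ = F₃} ferrers₁ ferrers₂ ferrers₄ m₁+m₂≤m₄ n₂+n₃≤n₄ union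
    (Ferrers.bounded ferrers₁₂) combination
    code₁₂ code₃ code₄
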